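{- Let $V=\{0,\mathbf{v}_1,\dots,\mathbf{v}_{q-1}\}\subset\mathbb{Z}^n$ with $|V|=q$ prime, and suppose $\mathbf{v}_1,\dots,\mathbf{v}_{q-1}$ generate $\mathbb{Z}^n$ as a group. Then there exists a tiling of $\mathbb{Z}^n$ by translates of $V$ if and only if there exists a lattice tiling of $\mathbb{Z}^n$ by translates of $V$.
   Context: A tiling of $\mathbb{Z}^n$ by translates of $V$ is a family $\{V+l: l\in\mathcal{L}\}$, $\mathcal{L}\subset\mathbb{Z}^n$, such that every $x\in\mathbb{Z}^n$ can be written uniquely as $x=v+l$ with $v\in V$, $l\in\mathcal{L}$. It is a lattice tiling if $\mathcal{L}$ is a subgroup of $\mathbb{Z}^n$. -}

module Defs where

open import Level using (0ℓ)
open import Data.Nat using (ℕ; suc)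
open import Data.Nat.Primality using (Prime)
open import Data.Integer using (ℤ; _+_; _*_; -_; +_)
open import Data.Fin using (Fin; zero; suc)
open import Data.Vec using (Vec; zipWith; map; replicate)
open import Data.Product using (Σ; ∃; _×_; _,_)
open import Relation.Binary.PropositionalEquality using (_≡_)
open import Relation.Unary using (Pred)
open import Function.Definitions using (Injective)

Point : ℕ → Set
Point n = Vec ℤ n

0ᵥ : ∀ {n} → Point n
0ᵥ = replicate _ (+ 0)

_+ᵥ_ : ∀ {n} → Point n → Point n → Point n
_+ᵥ_ = zipWith _+_

-ᵥ_ : ∀ {n} → Point n → Point n
-ᵥ_ = map -_

_·ᵥ_ : ∀ {n} → ℤ → Point n → Point n
c ·ᵥ x = map (c *_) x

lincomb : ∀ {n m} → (Fin m → ℤ) → (Fin m → Point n) → Point n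
lincomb {m = 0} c w = 0ᵥ
lincomb {m = suc m} c w = (c zero ·ᵥ w zero) +ᵥ lincomb (λ i → c (suc i)) (λ i → w (suc i))

Generates : ∀ {n m} → (Fin m → Point n) → Set
Generates {n} {m} w = ∀ (x : Point n) → ∃ λ (c : Fin m → ℤ) → lincomb c w ≡ x

-- V = {v i : i ∈ Fin q}, listed injectively (so |V| = q).
-- {V + l : l ∈ L} tiles ℤⁿ: every x = v i + l uniquely with l ∈ L.
IsTiling : ∀ {n q} → (Fin q → Point n) → Pred (Point n) 0ℓ → Set
IsTiling {n} {q} v L =
  ∀ (x : Point n) →
    (∃ λ (i : Fin q) → ∃ λ (l : Point n) → L l × v i +ᵥ l ≡ x)
  × (∀ (i j : Fin q) (l l′ : Point n) → L l → L l′ →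
       v i +ᵥ l ≡ x → v j +ᵥ l′ ≡ x → (i ≡ j × l ≡ l′))

IsSubgroup : ∀ {n} → Pred (Point n) 0ℓ → Set
IsSubgroup {n} L =
  L 0ᵥ × (∀ x y → L x → L y → L (x +ᵥ y)) × (∀ x → L x → L (-ᵥ x))

HasTiling : ∀ {n q} → (Fin q → Point n) → Set₁
HasTiling {n} v = Σ (Pred (Point n) 0ℓ) λ L → IsTiling v L

HasLatticeTiling : ∀ {n q} → (Fin q → Point n) → Set₁
HasLatticeTiling {n} v = Σ (Pred (Point n) 0ℓ) λ L → IsSubgroup L × IsTiling v L

-- Let 𝟙L be the indicator of the translation set, so ∑ᵢ 𝟙L (x - vᵢ) = 1. Modulo the prime p = |V| the operator
-- A f x = ∑ᵢ f (x - vᵢ) satisfies the Frobenius congruence Aᵖ f x ≡ ∑ᵢ f (x - p vᵢ), and Aᵖ 𝟙L = p^(p-1) ≡ 0.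
-- A sum of p values in {0,1} that is divisible by p is 0 or p, so 𝟙L is invariant under each p vᵢ, hence under pℤⁿ.
-- On the box {0,…,p-1}ⁿ the function 𝟙L is not constant, so by a discrete Radon inversion some direction w has
-- non-constant counts b c = #{y ∈ L ∩ box : w·y ≡ c}. With a c = #{i : w·vᵢ ≡ c}, the tiling identity makes the
-- cyclic convolution a ⋆ b constant. As p is prime, ℤ[x]/(1 + x + ⋯ + xᵖ⁻¹) has no zero divisors (proved by a
-- descent using Δᵖ ≡ 0 mod p), so a is constant, i.e. the w·vᵢ are distinct mod p and {x : w·x ≡ 0 (mod p)}
-- is a lattice tiling.

module Submission where

open import Defs
open import Level using (0ℓ)
open import Data.Nat as ℕ using (ℕ; zero; suc; z≤n; s≤s; _∸_; NonZero)
import Data.Nat.Properties as ℕₚ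
import Data.Nat.Divisibility as ℕ∣
open import Data.Nat.Primality using (Prime; euclidsLemma; ¬prime[1])
open import Data.Nat.Combinatorics using (_C_; nCk+nC[k+1]≡[n+1]C[k+1]; nCn≡1; nC1≡n; k>n⇒nCk≡0)
open import Data.Nat.Coprimality using (prime⇒coprime; coprime-Bézout)
open import Data.Nat.GCD using (module Bézout)
open import Data.Integer as ℤ using (ℤ; +_; -_; _+_; _*_; _-_; 0ℤ; 1ℤ; -[1+_]; ∣_∣)
import Data.Integer.Properties as ℤₚ
open import Data.Integer.Divisibility.Signed
  using (_∣_; divides; quotient; _∣?_; ∣⇒∣ᵤ; ∣ᵤ⇒∣; ∣m∣n⇒∣m+n; ∣m⇒∣-m; ∣n⇒∣m*n)
open import Data.Integer.DivMod using (_%ℕ_; _/ℕ_; n%ℕd<d; a≡a%ℕn+[a/ℕn]*n)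
open import Data.Integer.Tactic.RingSolver using (solve-∀)
open import Data.Fin as Fin using (Fin; zero; suc; toℕ; fromℕ)
import Data.Fin.Properties as Finₚ
open import Data.Vec as Vec using (Vec; []; _∷_)
open import Data.Vec.Relation.Binary.Pointwise.Inductive as Pointwise using (Pointwise; []; _∷_)
open import Data.Vec.Relation.Unary.Any using (Any; here; there; any?)
import Data.Vec.Properties as Vecₚ
open import Data.Product using (∃; _×_; _,_; proj₁; proj₂)
open import Data.Sum using (_⊎_; inj₁; inj₂; [_,_]′)
open import Data.Empty using (⊥; ⊥-elim)
open import Function using (_∘_; id)
open import Function.Definitions using (Injective)
open import Function.Bundles using (_⇔_; mk⇔)
open import Relation.Nullary using (¬_; Dec; yes; no)
open import Relation.Nullary.Decidable using (decidable-stable; ¬?; _→-dec_)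
open import Relation.Unary using (Pred)
open import Relation.Binary.Bundles using (Setoid)
open import Relation.Binary.Structures using (IsEquivalence)
import Relation.Binary.Reasoning.Setoid
open import Relation.Binary.PropositionalEquality
open import Algebra.Bundles using (Semiring)
open import Algebra.Properties.Semiring.Sum ℤₚ.+-*-semiring
  using (sum; sum-cong-≗; ∑-distrib-+; ∑-comm; sum-init-last; *-distribˡ-sum; *-distribʳ-sum)
import Algebra.Properties.Semiring.Sum ℕₚ.+-*-semiring as ℕΣ

module Sums where

  +-cancelʳ-≡ : ∀ a b c → a + c ≡ b + c → a ≡ b
  +-cancelʳ-≡ a b c e = trans (lemma a c) (trans (cong (_- c) e) (sym (lemma b c)))
    where lemma : ∀ a c → a ≡ a + c - c
          lemma = solve-∀

  pos-suc : ∀ m → + suc m ≡ 1ℤ + + m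
  pos-suc m = ℤₚ.pos-+ 1 m

  sum-const : ∀ m c → sum {m} (λ _ → c) ≡ + m * c
  sum-const zero    c = sym (ℤₚ.*-zeroˡ c)
  sum-const (suc m) c = trans (cong (_+_ c) (sum-const m c)) (sym (trans (cong (_* c) (pos-suc m)) (lemma (+ m) c)))
    where lemma : ∀ m c → (1ℤ + m) * c ≡ c + m * c
          lemma = solve-∀

  sum-zero : ∀ m → sum {m} (λ _ → 0ℤ) ≡ 0ℤ
  sum-zero m = trans (sum-const m 0ℤ) (ℤₚ.*-zeroʳ (+ m))

  ∑-distrib-- : ∀ {m} (f g : Fin m → ℤ) → sum (λ i → f i - g i) ≡ sum f - sum g
  ∑-distrib-- {zero}  f g = refl
  ∑-distrib-- {suc m} f g =
    trans (cong (_+_ (f zero - g zero)) (∑-distrib-- (f ∘ suc) (g ∘ suc))) (lemma (f zero) (g zero) _ _)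
    where lemma : ∀ a b c d → a - b + (c - d) ≡ a + c - (b + d)
          lemma = solve-∀

  sum-single : ∀ {m} (r : Fin m) (f : Fin m → ℤ) → (∀ i → i ≢ r → f i ≡ 0ℤ) → sum f ≡ f r
  sum-single {suc m} zero f f≡0 =
    trans (cong (_+_ (f zero)) (trans (sum-cong-≗ (λ i → f≡0 (suc i) λ ())) (sum-zero m))) (ℤₚ.+-identityʳ _)
  sum-single {suc m} (suc r) f f≡0 =
    trans (cong (_+ sum (f ∘ suc)) (f≡0 zero λ ()))
          (trans (ℤₚ.+-identityˡ _) (sum-single r (f ∘ suc) λ i i≢r → f≡0 (suc i) (i≢r ∘ Finₚ.suc-injective)))

  sum-differ-at : ∀ {m} (F R : Fin m → ℤ) t₀ → (∀ t → t ≢ t₀ → F t ≡ R t) → sum F ≡ sum R + (F t₀ - R t₀)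
  sum-differ-at F R t₀ F≡R = trans (lemma (sum F) (sum R)) (cong (_+_ (sum R)) (trans (sym (∑-distrib-- F R))
    (sum-single t₀ (λ t → F t - R t) λ t t≢t₀ → trans (cong (_- R t) (F≡R t t≢t₀)) (ℤₚ.+-inverseʳ (R t)))))
    where lemma : ∀ a b → a ≡ b + (a - b)
          lemma = solve-∀

  sum-nonzero : ∀ {m} (f : Fin m → ℤ) → sum f ≢ 0ℤ → ∃ λ i → f i ≢ 0ℤ
  sum-nonzero {zero}  f ne = ⊥-elim (ne refl)
  sum-nonzero {suc m} f ne with f zero ℤ.≟ 0ℤ
  ... | no f0≢0 = zero , f0≢0
  ... | yes f0≡0 with sum-nonzero (f ∘ suc) (λ e → ne (cong₂ _+_ f0≡0 e))
  ...   | i , fi≢0 = suc i , fi≢0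

  sum-pos : ∀ {m} (f : Fin m → ℕ) → sum (λ i → + f i) ≡ + ℕΣ.sum f
  sum-pos {zero}  f = refl
  sum-pos {suc m} f = trans (cong (_+_ (+ f zero)) (sum-pos (f ∘ suc))) (sym (ℤₚ.pos-+ (f zero) _))

  ℕsum-≥ : ∀ {m} (f : Fin m → ℕ) j → f j ℕ.≤ ℕΣ.sum f
  ℕsum-≥ {suc m} f zero    = ℕₚ.m≤m+n _ _
  ℕsum-≥ {suc m} f (suc j) = ℕₚ.≤-trans (ℕsum-≥ (f ∘ suc) j) (ℕₚ.m≤n+m _ (f zero))

  ℕsum-≥-two : ∀ {m} (f : Fin m → ℕ) i j → i ≢ j → f i ℕ.+ f j ℕ.≤ ℕΣ.sum f
  ℕsum-≥-two {suc m} f zero    zero    i≢j = ⊥-elim (i≢j refl)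
  ℕsum-≥-two {suc m} f zero    (suc j) i≢j = ℕₚ.+-monoʳ-≤ (f zero) (ℕsum-≥ (f ∘ suc) j)
  ℕsum-≥-two {suc m} f (suc i) zero    i≢j =
    subst (ℕ._≤ ℕΣ.sum f) (ℕₚ.+-comm (f zero) (f (suc i))) (ℕₚ.+-monoʳ-≤ (f zero) (ℕsum-≥ (f ∘ suc) i))
  ℕsum-≥-two {suc m} f (suc i) (suc j) i≢j =
    ℕₚ.≤-trans (ℕsum-≥-two (f ∘ suc) i j (i≢j ∘ cong suc)) (ℕₚ.m≤n+m _ (f zero))

  ℕsum-<-if-hole : ∀ {m} (f : Fin m → ℕ) → (∀ i → f i ℕ.≤ 1) → ∀ k → f k ≡ 0 → ℕΣ.sum f ℕ.< m
  ℕsum-<-if-hole {suc m} f f≤1 zero    fk≡0 =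
    s≤s (subst (λ z → z ℕ.+ ℕΣ.sum (f ∘ suc) ℕ.≤ m) (sym fk≡0) (sum≤ (f ∘ suc) (f≤1 ∘ suc)))
    where sum≤ : ∀ {m} (f : Fin m → ℕ) → (∀ i → f i ℕ.≤ 1) → ℕΣ.sum f ℕ.≤ m
          sum≤ {zero}  f f≤1 = z≤n
          sum≤ {suc m} f f≤1 = ℕₚ.+-mono-≤ (f≤1 zero) (sum≤ (f ∘ suc) (f≤1 ∘ suc))
  ℕsum-<-if-hole {suc m} f f≤1 (suc k) fk≡0 = ℕₚ.+-mono-≤-< (f≤1 zero) (ℕsum-<-if-hole (f ∘ suc) (f≤1 ∘ suc) k fk≡0)

  hole⇒∤sum : ∀ {m} (f : Fin m → ℕ) → (∀ i → f i ℕ.≤ 1) → ∀ {a b} → f a ≡ 1 → f b ≡ 0 → ¬ (m ℕ∣.∣ ℕΣ.sum f)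
  hole⇒∤sum f f≤1 {a} {b} fa≡1 fb≡0 = ℕ∣.>⇒∤ ⦃ nonzero ⦄ (ℕsum-<-if-hole f f≤1 b fb≡0)
    where nonzero : NonZero (ℕΣ.sum f)
          nonzero = ℕ.>-nonZero (ℕₚ.≤-trans (ℕₚ.≤-reflexive (sym fa≡1)) (ℕsum-≥ f a))

  all-or-none : ∀ {m} (f : Fin m → ℕ) → (∀ i → f i ℕ.≤ 1) → m ℕ∣.∣ ℕΣ.sum f → ∀ j k → f j ≡ f k
  all-or-none f f≤1 m∣sum j k with f j in fj | f k in fk | f≤1 j | f≤1 k
  ... | 0           | 0           | _      | _      = refl
  ... | 1           | 1           | _      | _      = refl
  ... | 1           | 0           | _      | _      = ⊥-elim (hole⇒∤sum f f≤1 fj fk m∣sum)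
  ... | 0           | 1           | _      | _      = ⊥-elim (hole⇒∤sum f f≤1 fk fj m∣sum)
  ... | suc (suc _) | _           | s≤s () | _
  ... | _           | suc (suc _) | _      | s≤s ()

open Sums

module Points where

  infixl 6 _-ᵥ_
  _-ᵥ_ : ∀ {n} → Point n → Point n → Point n
  x -ᵥ y = x +ᵥ (-ᵥ y)

  +ᵥ-comm : ∀ {n} (x y : Point n) → x +ᵥ y ≡ y +ᵥ x
  +ᵥ-comm = Vecₚ.zipWith-comm ℤₚ.+-comm

  +ᵥ-assoc : ∀ {n} (x y z : Point n) → (x +ᵥ y) +ᵥ z ≡ x +ᵥ (y +ᵥ z)
  +ᵥ-assoc = Vecₚ.zipWith-assoc ℤₚ.+-assoc

  +ᵥ-identityˡ : ∀ {n} (x : Point n) → 0ᵥ +ᵥ x ≡ x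
  +ᵥ-identityˡ = Vecₚ.zipWith-identityˡ ℤₚ.+-identityˡ

  +ᵥ-identityʳ : ∀ {n} (x : Point n) → x +ᵥ 0ᵥ ≡ x
  +ᵥ-identityʳ = Vecₚ.zipWith-identityʳ ℤₚ.+-identityʳ

  +ᵥ-inverseˡ : ∀ {n} (x : Point n) → (-ᵥ x) +ᵥ x ≡ 0ᵥ
  +ᵥ-inverseˡ = Vecₚ.zipWith-inverseˡ ℤₚ.+-inverseˡ

  +ᵥ-inverseʳ : ∀ {n} (x : Point n) → x -ᵥ x ≡ 0ᵥ
  +ᵥ-inverseʳ = Vecₚ.zipWith-inverseʳ ℤₚ.+-inverseʳ

  -ᵥ+ᵥ-cancel : ∀ {n} (x y : Point n) → (x -ᵥ y) +ᵥ y ≡ x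
  -ᵥ+ᵥ-cancel x y = begin
    (x -ᵥ y) +ᵥ y         ≡⟨ +ᵥ-assoc x (-ᵥ y) y ⟩
    x +ᵥ ((-ᵥ y) +ᵥ y)    ≡⟨ cong (x +ᵥ_) (+ᵥ-inverseˡ y) ⟩
    x +ᵥ 0ᵥ               ≡⟨ +ᵥ-identityʳ x ⟩
    x                     ∎
    where open ≡-Reasoning

  +ᵥ-ᵥ-cancel : ∀ {n} (x y : Point n) → (x +ᵥ y) -ᵥ y ≡ x
  +ᵥ-ᵥ-cancel x y = begin
    (x +ᵥ y) -ᵥ y         ≡⟨ +ᵥ-assoc x y (-ᵥ y) ⟩
    x +ᵥ (y -ᵥ y)         ≡⟨ cong (x +ᵥ_) (+ᵥ-inverseʳ y) ⟩
    x +ᵥ 0ᵥ               ≡⟨ +ᵥ-identityʳ x ⟩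
    x                     ∎
    where open ≡-Reasoning

  +ᵥ-cancelˡ : ∀ {n} (a x y : Point n) → a +ᵥ x ≡ a +ᵥ y → x ≡ y
  +ᵥ-cancelˡ a x y eq = begin
    x                     ≡⟨ +ᵥ-ᵥ-cancel x a ⟨
    (x +ᵥ a) -ᵥ a         ≡⟨ cong (_-ᵥ a) (trans (+ᵥ-comm x a) (trans eq (+ᵥ-comm a y))) ⟩
    (y +ᵥ a) -ᵥ a         ≡⟨ +ᵥ-ᵥ-cancel y a ⟩
    y                     ∎
    where open ≡-Reasoning

  -ᵥ-+ᵥ : ∀ {n} (x a b : Point n) → x -ᵥ a -ᵥ b ≡ x -ᵥ (a +ᵥ b)
  -ᵥ-+ᵥ []      []      []      = refl
  -ᵥ-+ᵥ (c ∷ x) (d ∷ a) (e ∷ b) = cong₂ _∷_ (lemma c d e) (-ᵥ-+ᵥ x a b)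
    where lemma : ∀ c d e → c - d - e ≡ c - (d + e)
          lemma = solve-∀

  -ᵥ-zero : ∀ {n} (x : Point n) → x -ᵥ 0ᵥ ≡ x
  -ᵥ-zero []      = refl
  -ᵥ-zero (c ∷ x) = cong₂ _∷_ (ℤₚ.+-identityʳ c) (-ᵥ-zero x)

  ·ᵥ-zeroˡ : ∀ {n} (x : Point n) → 0ℤ ·ᵥ x ≡ 0ᵥ
  ·ᵥ-zeroˡ []      = refl
  ·ᵥ-zeroˡ (a ∷ x) = cong₂ _∷_ (ℤₚ.*-zeroˡ a) (·ᵥ-zeroˡ x)

  ·ᵥ-zeroʳ : ∀ {n} c → c ·ᵥ 0ᵥ {n} ≡ 0ᵥ
  ·ᵥ-zeroʳ {zero}  c = refl
  ·ᵥ-zeroʳ {suc n} c = cong₂ _∷_ (ℤₚ.*-zeroʳ c) (·ᵥ-zeroʳ c)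

  ·ᵥ-suc : ∀ {n} m (x : Point n) → (+ suc m) ·ᵥ x ≡ x +ᵥ ((+ m) ·ᵥ x)
  ·ᵥ-suc m []      = refl
  ·ᵥ-suc m (a ∷ x) = cong₂ _∷_ (trans (cong (_* a) (pos-suc m)) (lemma (+ m) a)) (·ᵥ-suc m x)
    where lemma : ∀ m a → (1ℤ + m) * a ≡ a + m * a
          lemma = solve-∀

  ·ᵥ-negˡ : ∀ {n} c (x : Point n) → (- c) ·ᵥ x ≡ -ᵥ (c ·ᵥ x)
  ·ᵥ-negˡ c []      = refl
  ·ᵥ-negˡ c (a ∷ x) = cong₂ _∷_ (sym (ℤₚ.neg-distribˡ-* c a)) (·ᵥ-negˡ c x)

  ·ᵥ-negʳ : ∀ {n} c (x : Point n) → c ·ᵥ (-ᵥ x) ≡ -ᵥ (c ·ᵥ x)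
  ·ᵥ-negʳ c []      = refl
  ·ᵥ-negʳ c (a ∷ x) = cong₂ _∷_ (sym (ℤₚ.neg-distribʳ-* c a)) (·ᵥ-negʳ c x)

  ·ᵥ-distribˡ : ∀ {n} c (x y : Point n) → c ·ᵥ (x +ᵥ y) ≡ (c ·ᵥ x) +ᵥ (c ·ᵥ y)
  ·ᵥ-distribˡ c []      []      = refl
  ·ᵥ-distribˡ c (a ∷ x) (b ∷ y) = cong₂ _∷_ (ℤₚ.*-distribˡ-+ c a b) (·ᵥ-distribˡ c x y)

  infix 7 _∙_
  _∙_ : ∀ {n} → Point n → Point n → ℤ
  []      ∙ []      = 0ℤ
  (a ∷ x) ∙ (b ∷ y) = a * b + x ∙ y

  ∙-distribˡ-+ᵥ : ∀ {n} (w x y : Point n) → w ∙ (x +ᵥ y) ≡ w ∙ x + w ∙ y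
  ∙-distribˡ-+ᵥ []      []      []      = refl
  ∙-distribˡ-+ᵥ (c ∷ w) (a ∷ x) (b ∷ y) =
    trans (cong₂ _+_ (ℤₚ.*-distribˡ-+ c a b) (∙-distribˡ-+ᵥ w x y)) (lemma (c * a) (c * b) _ _)
    where lemma : ∀ a b c d → a + b + (c + d) ≡ a + c + (b + d)
          lemma = solve-∀

  ∙-negʳ : ∀ {n} (w x : Point n) → w ∙ (-ᵥ x) ≡ - (w ∙ x)
  ∙-negʳ []      []      = refl
  ∙-negʳ (c ∷ w) (a ∷ x) =
    trans (cong₂ _+_ (sym (ℤₚ.neg-distribʳ-* c a)) (∙-negʳ w x)) (sym (ℤₚ.neg-distrib-+ (c * a) (w ∙ x)))

  ∙-zeroʳ : ∀ {n} (w : Point n) → w ∙ 0ᵥ ≡ 0ℤ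
  ∙-zeroʳ []      = refl
  ∙-zeroʳ (c ∷ w) = trans (cong₂ _+_ (ℤₚ.*-zeroʳ c) (∙-zeroʳ w)) refl

  module _ {n} {H : Pred (Point n) 0ℓ} (subgroup : IsSubgroup H) where

    private
      H0 = proj₁ subgroup
      H+ = proj₁ (proj₂ subgroup)
      H- = proj₂ (proj₂ subgroup)

    subgroup-·ᵥ-pos : ∀ m {x} → H x → H ((+ m) ·ᵥ x)
    subgroup-·ᵥ-pos zero    {x} _  = subst H (sym (·ᵥ-zeroˡ x)) H0
    subgroup-·ᵥ-pos (suc m) {x} hx = subst H (sym (·ᵥ-suc m x)) (H+ _ _ hx (subgroup-·ᵥ-pos m hx))

    subgroup-·ᵥ : ∀ c {x} → H x → H (c ·ᵥ x)
    subgroup-·ᵥ (+ m)      hx = subgroup-·ᵥ-pos m hx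
    subgroup-·ᵥ -[1+ m ] {x} hx = subst H (sym (·ᵥ-negˡ (+ suc m) x)) (H- _ (subgroup-·ᵥ-pos (suc m) hx))

    subgroup-lincomb : ∀ {m} (c : Fin m → ℤ) (w : Fin m → Point n) → (∀ i → H (w i)) → H (lincomb c w)
    subgroup-lincomb {zero}  c w hw = H0
    subgroup-lincomb {suc m} c w hw =
      H+ _ _ (subgroup-·ᵥ (c zero) (hw zero)) (subgroup-lincomb (c ∘ suc) (w ∘ suc) (hw ∘ suc))

    generators⊆⇒total : ∀ {m} {w : Fin m → Point n} → Generates w → (∀ i → H (w i)) → ∀ x → H x
    generators⊆⇒total {w = w} gen hw x with gen x
    ... | c , lincomb≡x = subst H lincomb≡x (subgroup-lincomb c w hw)

open Points

module BinomialCoefficients where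

  absorption : ∀ n k → suc k ℕ.* (suc n C suc k) ≡ suc n ℕ.* (n C k)
  absorption zero    zero    = refl
  absorption zero    (suc k) rewrite k>n⇒nCk≡0 {1} {suc (suc k)} (s≤s (s≤s z≤n)) | k>n⇒nCk≡0 {0} {suc k} (s≤s z≤n) =
    ℕₚ.*-zeroʳ (suc (suc k))
  absorption (suc n) zero    = trans (ℕₚ.*-identityˡ _) (trans (nC1≡n (suc (suc n))) (sym (ℕₚ.*-identityʳ _)))
  absorption (suc n) (suc k) = begin
    suc (suc k) ℕ.* (suc (suc n) C suc (suc k))
      ≡⟨ cong (suc (suc k) ℕ.*_) (nCk+nC[k+1]≡[n+1]C[k+1] (suc n) (suc k)) ⟨
    suc (suc k) ℕ.* (suc n C suc k ℕ.+ suc n C suc (suc k))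
      ≡⟨ ℕₚ.*-distribˡ-+ (suc (suc k)) (suc n C suc k) _ ⟩
    suc n C suc k ℕ.+ suc k ℕ.* (suc n C suc k) ℕ.+ suc (suc k) ℕ.* (suc n C suc (suc k))
      ≡⟨ cong₂ (λ a b → suc n C suc k ℕ.+ a ℕ.+ b) (absorption n k) (absorption n (suc k)) ⟩
    suc n C suc k ℕ.+ suc n ℕ.* (n C k) ℕ.+ suc n ℕ.* (n C suc k)
      ≡⟨ ℕₚ.+-assoc (suc n C suc k) _ _ ⟩
    suc n C suc k ℕ.+ (suc n ℕ.* (n C k) ℕ.+ suc n ℕ.* (n C suc k))
      ≡⟨ cong (suc n C suc k ℕ.+_) (ℕₚ.*-distribˡ-+ (suc n) (n C k) (n C suc k)) ⟨
    suc n C suc k ℕ.+ suc n ℕ.* (n C k ℕ.+ n C suc k)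
      ≡⟨ cong (λ z → suc n C suc k ℕ.+ suc n ℕ.* z) (nCk+nC[k+1]≡[n+1]C[k+1] n k) ⟩
    suc (suc n) ℕ.* (suc n C suc k) ∎
    where open ≡-Reasoning

  prime∣pCk : ∀ {p} → Prime p → ∀ k → 0 ℕ.< k → k ℕ.< p → p ℕ∣.∣ (p C k)
  prime∣pCk {suc n} p-prime (suc k) _ k<p
    with euclidsLemma (suc k) (suc n C suc k) p-prime (ℕ∣.divides (n C k) (trans (absorption n k) (ℕₚ.*-comm (suc n) (n C k))))
  ... | inj₁ p∣k    = ⊥-elim (ℕ∣.>⇒∤ k<p p∣k)
  ... | inj₂ p∣pCk = p∣pCk

open BinomialCoefficients

module Modulo (p : ℕ) ⦃ _ : NonZero p ⦄ where

  P : ℤ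
  P = + p

  -- A record rather than an alias of P ∣ a - b, so that a and b can be inferred from a proof of a ≡ₚ b.
  infix 4 _≡ₚ_
  record _≡ₚ_ (a b : ℤ) : Set where
    constructor mk
    field divides-difference : P ∣ a - b
  open _≡ₚ_ public

  private
    infixl 1 _by_
    _by_ : ∀ {x y} → P ∣ x → x ≡ y → P ∣ y
    d by eq = subst (P ∣_) eq d

  ≡ₚ-refl : ∀ {a} → a ≡ₚ a
  ≡ₚ-refl {a} = mk (divides 0ℤ (ℤₚ.+-inverseʳ a))

  ≡⇒≡ₚ : ∀ {a b} → a ≡ b → a ≡ₚ b
  ≡⇒≡ₚ refl = ≡ₚ-refl

  ≡ₚ-sym : ∀ {a b} → a ≡ₚ b → b ≡ₚ a
  ≡ₚ-sym {a} {b} (mk d) = mk (∣m⇒∣-m d by lemma a b)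
    where lemma : ∀ a b → - (a - b) ≡ b - a
          lemma = solve-∀

  ≡ₚ-trans : ∀ {a b c} → a ≡ₚ b → b ≡ₚ c → a ≡ₚ c
  ≡ₚ-trans {a} {b} {c} (mk d) (mk e) = mk (∣m∣n⇒∣m+n d e by lemma a b c)
    where lemma : ∀ a b c → (a - b) + (b - c) ≡ a - c
          lemma = solve-∀

  ≡ₚ-isEquivalence : IsEquivalence _≡ₚ_
  ≡ₚ-isEquivalence = record { refl = ≡ₚ-refl ; sym = ≡ₚ-sym ; trans = ≡ₚ-trans }

  ≡ₚ-setoid : Setoid 0ℓ 0ℓ
  ≡ₚ-setoid = record { isEquivalence = ≡ₚ-isEquivalence }

  module ≡ₚ-Reasoning = Relation.Binary.Reasoning.Setoid ≡ₚ-setoid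

  ≡ₚ-+ : ∀ {a b c d} → a ≡ₚ b → c ≡ₚ d → a + c ≡ₚ b + d
  ≡ₚ-+ {a} {b} {c} {d} (mk e) (mk f) = mk (∣m∣n⇒∣m+n e f by lemma a b c d)
    where lemma : ∀ a b c d → (a - b) + (c - d) ≡ a + c - (b + d)
          lemma = solve-∀

  ≡ₚ-neg : ∀ {a b} → a ≡ₚ b → - a ≡ₚ - b
  ≡ₚ-neg {a} {b} (mk e) = mk (∣m⇒∣-m e by lemma a b)
    where lemma : ∀ a b → - (a - b) ≡ - a - - b
          lemma = solve-∀

  ≡ₚ-- : ∀ {a b c d} → a ≡ₚ b → c ≡ₚ d → a - c ≡ₚ b - d
  ≡ₚ-- e f = ≡ₚ-+ e (≡ₚ-neg f)

  ≡ₚ-*ˡ : ∀ k {a b} → a ≡ₚ b → k * a ≡ₚ k * b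
  ≡ₚ-*ˡ k {a} {b} (mk e) = mk (∣n⇒∣m*n k e by lemma k a b)
    where lemma : ∀ k a b → k * (a - b) ≡ k * a - k * b
          lemma = solve-∀

  ≡ₚ-*ʳ : ∀ k {a b} → a ≡ₚ b → a * k ≡ₚ b * k
  ≡ₚ-*ʳ k {a} {b} e = subst₂ _≡ₚ_ (ℤₚ.*-comm k a) (ℤₚ.*-comm k b) (≡ₚ-*ˡ k e)

  a+kP≡ₚa : ∀ k a → a + k * P ≡ₚ a
  a+kP≡ₚa k a = mk (divides k (lemma a k P))
    where lemma : ∀ a k P → a + k * P - a ≡ k * P
          lemma = solve-∀

  P*-cancel : ∀ {a b} → P * a ≡ P * b → a ≡ b
  P*-cancel {a} {b} = ℤₚ.*-cancelˡ-≡ P a b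

  ∣⇒≡ₚ0 : ∀ {a} → P ∣ a → a ≡ₚ 0ℤ
  ∣⇒≡ₚ0 {a} d = mk (d by sym (ℤₚ.+-identityʳ a))

  ≡ₚ0⇒∣ : ∀ {a} → a ≡ₚ 0ℤ → P ∣ a
  ≡ₚ0⇒∣ {a} (mk d) = d by ℤₚ.+-identityʳ a

  infix 4 _≟ₚ_
  _≟ₚ_ : ∀ a b → Dec (a ≡ₚ b)
  a ≟ₚ b with P ∣? (a - b)
  ... | yes d  = yes (mk d)
  ... | no ¬d  = no (¬d ∘ divides-difference)

  ⟪_⟫ : Fin p → ℤ
  ⟪ c ⟫ = + toℕ c

  residue : ℤ → Fin p
  residue a = Fin.fromℕ< (n%ℕd<d a p)

  ⟪residue⟫ : ∀ a → ⟪ residue a ⟫ ≡ₚ a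
  ⟪residue⟫ a = subst (_≡ₚ a) (cong +_ (sym (Finₚ.toℕ-fromℕ< (n%ℕd<d a p))))
                       (≡ₚ-sym (mk (divides (a /ℕ p) (cancel (a≡a%ℕn+[a/ℕn]*n a p)))))
    where cancel : ∀ {a r k} → a ≡ r + k → a - r ≡ k
          cancel {r = r} {k} refl = lemma r k
            where lemma : ∀ r k → r + k - r ≡ k
                  lemma = solve-∀

  <p-≡ₚ⇒≡ : ∀ {c c′} → c ℕ.< p → c′ ℕ.< p → + c ≡ₚ + c′ → c ≡ c′
  <p-≡ₚ⇒≡ {c} {c′} c<p c′<p (mk d) with ∣ + c - + c′ ∣ in eq
  ... | zero  = ℤₚ.+-injective (ℤₚ.i-j≡0⇒i≡j _ _ (ℤₚ.∣i∣≡0⇒i≡0 eq))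
  ... | suc _ = ⊥-elim (ℕ∣.>⇒∤ (subst (ℕ._< p) eq bound) (subst (p ℕ∣.∣_) eq (∣⇒∣ᵤ d)))
    where
    bound : ∣ + c - + c′ ∣ ℕ.< p
    bound = ℕₚ.≤-<-trans (ℕₚ.≤-trans (ℕₚ.≤-reflexive (cong ∣_∣ (ℤₚ.m-n≡m⊖n c c′))) (ℤₚ.∣m⊝n∣≤m⊔n c c′))
                          (ℕₚ.⊔-lub c<p c′<p)

  ⟪⟫-injectiveₚ : ∀ {c d : Fin p} → ⟪ c ⟫ ≡ₚ ⟪ d ⟫ → c ≡ d
  ⟪⟫-injectiveₚ {c} {d} e = Finₚ.toℕ-injective (<p-≡ₚ⇒≡ (Finₚ.toℕ<n c) (Finₚ.toℕ<n d) e)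

  residue-⟪⟫ : ∀ c → residue ⟪ c ⟫ ≡ c
  residue-⟪⟫ c = ⟪⟫-injectiveₚ (⟪residue⟫ ⟪ c ⟫)

  residue-cong : ∀ {a b} → a ≡ₚ b → residue a ≡ residue b
  residue-cong e = ⟪⟫-injectiveₚ (≡ₚ-trans (⟪residue⟫ _) (≡ₚ-trans e (≡ₚ-sym (⟪residue⟫ _))))

  Periodic : (ℤ → ℤ) → Set
  Periodic h = ∀ {a b} → a ≡ₚ b → h a ≡ h b

  Constant : (ℤ → ℤ) → Set
  Constant f = ∀ (c : Fin p) → f ⟪ c ⟫ ≡ f 0ℤ

  Constant? : ∀ f → Dec (Constant f)
  Constant? f = Finₚ.all? (λ c → f ⟪ c ⟫ ℤ.≟ f 0ℤ)

  periodic-constant : ∀ {f} → Periodic f → Constant f → ∀ y → f y ≡ f 0ℤ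
  periodic-constant pf cf y = trans (sym (pf (⟪residue⟫ y))) (cf (residue y))

  δ : ℤ → ℤ → ℤ
  δ a b with a ≟ₚ b
  ... | yes _ = 1ℤ
  ... | no  _ = 0ℤ

  δ-yes : ∀ {a b} → a ≡ₚ b → δ a b ≡ 1ℤ
  δ-yes {a} {b} e with a ≟ₚ b
  ... | yes _ = refl
  ... | no ne = ⊥-elim (ne e)

  δ-no : ∀ {a b} → ¬ (a ≡ₚ b) → δ a b ≡ 0ℤ
  δ-no {a} {b} ne with a ≟ₚ b
  ... | yes e = ⊥-elim (ne e)
  ... | no  _ = refl

  δ-nonneg : ∀ a b → δ a b ≡ + ∣ δ a b ∣
  δ-nonneg a b with a ≟ₚ b
  ... | yes _ = refl
  ... | no  _ = refl

  δ≢0⇒≡ₚ : ∀ {a b} → δ a b ≢ 0ℤ → a ≡ₚ b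
  δ≢0⇒≡ₚ {a} {b} nz with a ≟ₚ b
  ... | yes e = e
  ... | no  _ = ⊥-elim (nz refl)

  δ-iff : ∀ {a b c d} → (a ≡ₚ b → c ≡ₚ d) → (c ≡ₚ d → a ≡ₚ b) → δ a b ≡ δ c d
  δ-iff {a} {b} {c} {d} to from with a ≟ₚ b | c ≟ₚ d
  ... | yes _ | yes _ = refl
  ... | yes x | no ¬y = ⊥-elim (¬y (to x))
  ... | no ¬x | yes y = ⊥-elim (¬x (from y))
  ... | no _  | no _  = refl

  δ-cong : ∀ {a b a′ b′} → a ≡ₚ a′ → b ≡ₚ b′ → δ a b ≡ δ a′ b′
  δ-cong ea eb = δ-iff (λ e → ≡ₚ-trans (≡ₚ-sym ea) (≡ₚ-trans e eb)) (λ e → ≡ₚ-trans ea (≡ₚ-trans e (≡ₚ-sym eb)))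

  sum-δ : ∀ h → Periodic h → ∀ a → sum {p} (λ c → δ ⟪ c ⟫ a * h ⟪ c ⟫) ≡ h a
  sum-δ h ph a = begin
    sum (λ c → δ ⟪ c ⟫ a * h ⟪ c ⟫) ≡⟨ sum-single (residue a) _ off-diagonal ⟩
    δ ⟪ r ⟫ a * h ⟪ r ⟫             ≡⟨ cong (_* h ⟪ r ⟫) (δ-yes (⟪residue⟫ a)) ⟩
    1ℤ * h ⟪ r ⟫                    ≡⟨ ℤₚ.*-identityˡ _ ⟩
    h ⟪ r ⟫                         ≡⟨ ph (⟪residue⟫ a) ⟩
    h a                             ∎
    where
    open ≡-Reasoning
    r = residue a
    off-diagonal : ∀ c → c ≢ r → δ ⟪ c ⟫ a * h ⟪ c ⟫ ≡ 0ℤ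
    off-diagonal c c≢r = trans (cong (_* h ⟪ c ⟫) (δ-no λ e → c≢r (⟪⟫-injectiveₚ (≡ₚ-trans e (≡ₚ-sym (⟪residue⟫ a))))))
                               (ℤₚ.*-zeroˡ (h ⟪ c ⟫))

  sum-δ₁ : ∀ a → sum {p} (λ c → δ ⟪ c ⟫ a) ≡ 1ℤ
  sum-δ₁ a = trans (sum-cong-≗ λ c → sym (ℤₚ.*-identityʳ (δ ⟪ c ⟫ a))) (sum-δ (λ _ → 1ℤ) (λ _ → refl) a)

  δ-sum≡1⇒∃ : ∀ {m} z (u : Fin m → ℤ) → sum (λ k → δ z (u k)) ≡ 1ℤ → ∃ λ i → z ≡ₚ u i
  δ-sum≡1⇒∃ z u sum≡1 with sum-nonzero (λ k → δ z (u k)) (λ sum≡0 → 1≢0 (trans (sym sum≡1) sum≡0))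
    where 1≢0 : 1ℤ ≢ 0ℤ
          1≢0 ()
  ... | i , δ≢0 = i , δ≢0⇒≡ₚ δ≢0

  δ-sum≡1⇒unique : ∀ {m} z (u : Fin m → ℤ) → sum (λ k → δ z (u k)) ≡ 1ℤ → ∀ {i j} → z ≡ₚ u i → z ≡ₚ u j → i ≡ j
  δ-sum≡1⇒unique z u sum≡1 {i} {j} z≡uᵢ z≡uⱼ = decidable-stable (i Fin.≟ j) λ i≢j →
    ℕₚ.<-irrefl (refl {x = 1}) (subst (2 ℕ.≤_) ℕsum≡1
      (subst₂ (λ a b → a ℕ.+ b ℕ.≤ ℕΣ.sum f) (cong ∣_∣ (δ-yes z≡uᵢ)) (cong ∣_∣ (δ-yes z≡uⱼ)) (ℕsum-≥-two f i j i≢j)))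
    where
    f : Fin _ → ℕ
    f k = ∣ δ z (u k) ∣
    ℕsum≡1 : ℕΣ.sum f ≡ 1
    ℕsum≡1 = ℤₚ.+-injective (trans (sym (sum-pos f)) (trans (sym (sum-cong-≗ (λ k → δ-nonneg z (u k)))) sum≡1))

module PrimeModulus (q : ℕ) (p-prime : Prime (suc q)) where

  p : ℕ
  p = suc q

  open Modulo p public

  1<p : 1 ℕ.< p
  1<p = prime>1 p-prime
    where prime>1 : ∀ {k} → Prime (suc k) → 1 ℕ.< suc k
          prime>1 {zero}  prime[1] = ⊥-elim (¬prime[1] prime[1])
          prime>1 {suc _} _        = s≤s (s≤s z≤n)

  1≢ₚ0 : ¬ (1ℤ ≡ₚ 0ℤ)
  1≢ₚ0 e with <p-≡ₚ⇒≡ 1<p (s≤s z≤n) e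
  ... | ()

  ⟪⟫-distinct : ∀ {c d : Fin p} → c ≢ d → ¬ (⟪ c ⟫ - ⟪ d ⟫ ≡ₚ 0ℤ)
  ⟪⟫-distinct {c} {d} c≢d e = c≢d (⟪⟫-injectiveₚ (begin
    ⟪ c ⟫                  ≡⟨ lemma ⟪ c ⟫ ⟪ d ⟫ ⟩
    ⟪ c ⟫ - ⟪ d ⟫ + ⟪ d ⟫  ≈⟨ ≡ₚ-+ e ≡ₚ-refl ⟩
    0ℤ + ⟪ d ⟫             ≡⟨ ℤₚ.+-identityˡ ⟪ d ⟫ ⟩
    ⟪ d ⟫                  ∎))
    where
    open ≡ₚ-Reasoning
    lemma : ∀ a b → a ≡ a - b + b
    lemma = solve-∀

  euclidₚ : ∀ x y → x * y ≡ₚ 0ℤ → x ≡ₚ 0ℤ ⊎ y ≡ₚ 0ℤ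
  euclidₚ x y e with euclidsLemma ∣ x ∣ ∣ y ∣ p-prime (subst (p ℕ∣.∣_) (ℤₚ.∣i*j∣≡∣i∣*∣j∣ x y) (∣⇒∣ᵤ (≡ₚ0⇒∣ e)))
  ... | inj₁ p∣x = inj₁ (∣⇒≡ₚ0 (∣ᵤ⇒∣ p∣x))
  ... | inj₂ p∣y = inj₂ (∣⇒≡ₚ0 (∣ᵤ⇒∣ p∣y))

  private
    cast : ∀ a b c d → 1 ℕ.+ a ℕ.* b ≡ c ℕ.* d → 1ℤ + + a * + b ≡ + c * + d
    cast a b c d e =
      trans (cong (_+_ 1ℤ) (sym (ℤₚ.pos-* a b))) (trans (sym (ℤₚ.pos-+ 1 (a ℕ.* b))) (trans (cong +_ e) (ℤₚ.pos-* c d)))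

  inverse-of-small : ∀ r → 0 ℕ.< r → r ℕ.< p → ∃ λ r′ → + r * r′ ≡ₚ 1ℤ
  inverse-of-small r@(suc _) _ r<p with coprime-Bézout (prime⇒coprime p-prime r<p)
  ... | Bézout.+- x y eq = - + y , mk (divides (- + x) (trans (lemma₁ (+ r) (+ y)) (trans (cong -_ (cast y r x p eq)) (ℤₚ.neg-distribˡ-* (+ x) P))))
    where lemma₁ : ∀ r y → r * - y - 1ℤ ≡ - (1ℤ + y * r)
          lemma₁ = solve-∀
  ... | Bézout.-+ x y eq = + y , mk (divides (+ x) (trans (lemma₂ (+ r) (+ y)) (trans (cong (_- 1ℤ) (sym (cast x p y r eq))) (lemma₃ (+ x) P))))
    where lemma₂ : ∀ r y → r * y - 1ℤ ≡ y * r - 1ℤ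
          lemma₂ = solve-∀
          lemma₃ : ∀ x P → 1ℤ + x * P - 1ℤ ≡ x * P
          lemma₃ = solve-∀

  inverse : ∀ k → ¬ (k ≡ₚ 0ℤ) → ∃ λ k′ → k * k′ ≡ₚ 1ℤ
  inverse k k≢0 with toℕ (residue k) in r≡ | ⟪residue⟫ k
  ... | zero  | 0≡k = ⊥-elim (k≢0 (≡ₚ-sym 0≡k))
  ... | suc r | r≡k with inverse-of-small (suc r) (s≤s z≤n) (subst (ℕ._< p) r≡ (Finₚ.toℕ<n (residue k)))
  ...   | k′ , rk′≡1 = k′ , ≡ₚ-trans (≡ₚ-*ʳ k′ (≡ₚ-sym r≡k)) rk′≡1

  total : (ℤ → ℤ) → ℤ
  total h = sum {p} (λ c → h ⟪ c ⟫)

  δ-affine-swap : ∀ {k k′} → k * k′ ≡ₚ 1ℤ → ∀ t x y → δ x (k * y + t) ≡ δ y (k′ * (x - t))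
  δ-affine-swap {k} {k′} kk′≡1 t x y = δ-iff to from
    where
    open ≡ₚ-Reasoning
    kk′-cancel : ∀ z → z ≡ₚ (k * k′) * z
    kk′-cancel z = ≡ₚ-trans (≡⇒≡ₚ (sym (ℤₚ.*-identityˡ z))) (≡ₚ-*ʳ z (≡ₚ-sym kk′≡1))
    lemma₁ : ∀ k k′ y t → (k * k′) * y ≡ k′ * (k * y + t - t)
    lemma₁ = solve-∀
    lemma₂ : ∀ k k′ x t → (k * k′) * (x - t) + t ≡ k * (k′ * (x - t)) + t
    lemma₂ = solve-∀
    lemma₃ : ∀ x t → x ≡ (x - t) + t
    lemma₃ = solve-∀
    to : x ≡ₚ k * y + t → y ≡ₚ k′ * (x - t)
    to e = begin
      y                       ≈⟨ kk′-cancel y ⟩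
      (k * k′) * y            ≡⟨ lemma₁ k k′ y t ⟩
      k′ * (k * y + t - t)    ≈⟨ ≡ₚ-*ˡ k′ (≡ₚ-- (≡ₚ-sym e) ≡ₚ-refl) ⟩
      k′ * (x - t)            ∎
    from : y ≡ₚ k′ * (x - t) → x ≡ₚ k * y + t
    from e = begin
      x                           ≡⟨ lemma₃ x t ⟩
      (x - t) + t                 ≈⟨ ≡ₚ-+ (kk′-cancel (x - t)) ≡ₚ-refl ⟩
      (k * k′) * (x - t) + t      ≡⟨ lemma₂ k k′ x t ⟩
      k * (k′ * (x - t)) + t      ≈⟨ ≡ₚ-+ (≡ₚ-*ˡ k (≡ₚ-sym e)) ≡ₚ-refl ⟩
      k * y + t                   ∎

  sum-affine : ∀ h → Periodic h → ∀ k t → ¬ (k ≡ₚ 0ℤ) → sum {p} (λ c → h (k * ⟪ c ⟫ + t)) ≡ total h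
  sum-affine h ph k t k≢0 with inverse k k≢0
  ... | k′ , kk′≡1 = begin
    sum (λ c → h (k * ⟪ c ⟫ + t))
      ≡⟨ sum-cong-≗ (λ c → sum-δ h ph (k * ⟪ c ⟫ + t)) ⟨
    sum (λ c → sum (λ d → δ ⟪ d ⟫ (k * ⟪ c ⟫ + t) * h ⟪ d ⟫))
      ≡⟨ ∑-comm (λ c d → δ ⟪ d ⟫ (k * ⟪ c ⟫ + t) * h ⟪ d ⟫) ⟩
    sum (λ d → sum (λ c → δ ⟪ d ⟫ (k * ⟪ c ⟫ + t) * h ⟪ d ⟫))
      ≡⟨ sum-cong-≗ (λ d → *-distribʳ-sum (h ⟪ d ⟫) (λ c → δ ⟪ d ⟫ (k * ⟪ c ⟫ + t))) ⟨
    sum (λ d → sum (λ c → δ ⟪ d ⟫ (k * ⟪ c ⟫ + t)) * h ⟪ d ⟫)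
      ≡⟨ sum-cong-≗ (λ d → cong (_* h ⟪ d ⟫) (trans (sum-cong-≗ (δ-affine-swap {k} {k′} kk′≡1 t ⟪ d ⟫ ∘ ⟪_⟫))
                                                    (sum-δ₁ (k′ * (⟪ d ⟫ - t))))) ⟩
    sum (λ d → 1ℤ * h ⟪ d ⟫)
      ≡⟨ sum-cong-≗ (λ d → ℤₚ.*-identityˡ (h ⟪ d ⟫)) ⟩
    total h ∎
    where open ≡-Reasoning

  sum-translate : ∀ h → Periodic h → ∀ t → sum {p} (λ c → h (⟪ c ⟫ + t)) ≡ total h
  sum-translate h ph t = trans (sum-cong-≗ λ c → cong (λ z → h (z + t)) (sym (ℤₚ.*-identityˡ ⟪ c ⟫))) (sum-affine h ph 1ℤ t 1≢ₚ0)

  sum-≡ₚ-last : ∀ {n} (G : Fin (suc n) → ℤ) → (∀ i → G (Fin.inject₁ i) ≡ₚ 0ℤ) → sum G ≡ₚ G (fromℕ n)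
  sum-≡ₚ-last {zero}  G _      = ≡⇒≡ₚ (ℤₚ.+-identityʳ _)
  sum-≡ₚ-last {suc n} G init≡0 =
    ≡ₚ-trans (≡ₚ-+ (init≡0 zero) (sum-≡ₚ-last (G ∘ suc) (init≡0 ∘ suc))) (≡⇒≡ₚ (ℤₚ.+-identityˡ _))

  multiple≡ₚ0 : ∀ c y → p ℕ∣.∣ c → + c * y ≡ₚ 0ℤ
  multiple≡ₚ0 c y (ℕ∣.divides d refl) = ≡ₚ-trans (≡⇒≡ₚ (trans (cong (_* y) (ℤₚ.pos-* d p)) (lemma (+ d) P y))) (a+kP≡ₚa (+ d * y) 0ℤ)
    where lemma : ∀ d P y → d * P * y ≡ 0ℤ + (d * y) * P
          lemma = solve-∀

module Operators (X : Set) where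

  record Operator : Set where
    field
      apply      : (X → ℤ) → X → ℤ
      apply-cong : ∀ {f g} → (∀ x → f x ≡ g x) → ∀ x → apply f x ≡ apply g x
      apply-+    : ∀ f g x → apply (λ y → f y + g y) x ≡ apply f x + apply g x
      apply-0    : ∀ x → apply (λ _ → 0ℤ) x ≡ 0ℤ
  open Operator public

  infix 4 _≈_
  _≈_ : Operator → Operator → Set
  F ≈ G = ∀ f x → apply F f x ≡ apply G f x

  infixl 6 _⊕_
  infixl 7 _⊛_

  _⊕_ : Operator → Operator → Operator
  F ⊕ G = record
    { apply      = λ f x → apply F f x + apply G f x
    ; apply-cong = λ e x → cong₂ _+_ (apply-cong F e x) (apply-cong G e x)
    ; apply-+    = λ f g x → trans (cong₂ _+_ (apply-+ F f g x) (apply-+ G f g x))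
                                   (lemma (apply F f x) (apply F g x) (apply G f x) (apply G g x))
    ; apply-0    = λ x → cong₂ _+_ (apply-0 F x) (apply-0 G x)
    }
    where lemma : ∀ a b c d → a + b + (c + d) ≡ a + c + (b + d)
          lemma = solve-∀

  _⊛_ : Operator → Operator → Operator
  F ⊛ G = record
    { apply      = λ f → apply F (apply G f)
    ; apply-cong = λ e → apply-cong F (apply-cong G e)
    ; apply-+    = λ f g x → trans (apply-cong F (apply-+ G f g) x) (apply-+ F (apply G f) (apply G g) x)
    ; apply-0    = λ x → trans (apply-cong F (apply-0 G) x) (apply-0 F x)
    }

  𝟘 : Operator
  𝟘 = record { apply = λ _ _ → 0ℤ ; apply-cong = λ _ _ → refl ; apply-+ = λ _ _ _ → refl ; apply-0 = λ _ → refl }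

  𝟙 : Operator
  𝟙 = record { apply = λ f → f ; apply-cong = λ e → e ; apply-+ = λ _ _ _ → refl ; apply-0 = λ _ → refl }

  operator-semiring : Semiring 0ℓ 0ℓ
  operator-semiring = record
    { _≈_ = _≈_ ; _+_ = _⊕_ ; _*_ = _⊛_ ; 0# = 𝟘 ; 1# = 𝟙
    ; isSemiring = record
      { isSemiringWithoutAnnihilatingZero = record
        { +-isCommutativeMonoid = record
          { isMonoid = record
            { isSemigroup = record
              { isMagma = record
                { isEquivalence = record
                  { refl = λ f x → refl ; sym = λ e f x → sym (e f x) ; trans = λ e e′ f x → trans (e f x) (e′ f x) }
                ; ∙-cong = λ e e′ f x → cong₂ _+_ (e f x) (e′ f x) }
              ; assoc = λ F G H f x → ℤₚ.+-assoc (apply F f x) (apply G f x) (apply H f x) }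
            ; identity = (λ F f x → ℤₚ.+-identityˡ (apply F f x)) , (λ F f x → ℤₚ.+-identityʳ (apply F f x)) }
          ; comm = λ F G f x → ℤₚ.+-comm (apply F f x) (apply G f x) }
        ; *-cong = λ {F} {_} {_} {G′} e e′ f x → trans (apply-cong F (e′ f) x) (e (apply G′ f) x)
        ; *-assoc = λ _ _ _ _ _ → refl
        ; *-identity = (λ _ _ _ → refl) , (λ _ _ _ → refl)
        ; distrib = (λ F G H f x → apply-+ F (apply G f) (apply H f) x) , (λ _ _ _ _ _ → refl) }
      ; zero = (λ _ _ _ → refl) , (λ F f x → apply-0 F x) }
    }

  open import Algebra.Properties.Semiring.Exp operator-semiring using () renaming (_^_ to _^ᵒ_) public
  open import Algebra.Properties.Monoid.Mult (Semiring.+-monoid operator-semiring) using () renaming (_×_ to _×ᵒ_)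
  open import Algebra.Properties.Monoid.Sum (Semiring.+-monoid operator-semiring) using () renaming (sum to sumᵒ)

  apply-× : ∀ n F f x → apply (n ×ᵒ F) f x ≡ + n * apply F f x
  apply-× zero    F f x = sym (ℤₚ.*-zeroˡ (apply F f x))
  apply-× (suc n) F f x = trans (cong (_+_ (apply F f x)) (apply-× n F f x)) (sym (trans (cong (_* apply F f x) (pos-suc n)) (lemma (+ n) (apply F f x))))
    where lemma : ∀ n a → (1ℤ + n) * a ≡ a + n * a
          lemma = solve-∀

  apply-sum : ∀ {n} (T : Fin n → Operator) f x → apply (sumᵒ T) f x ≡ sum (λ k → apply (T k) f x)
  apply-sum {zero}  T f x = refl
  apply-sum {suc n} T f x = cong (_+_ (apply (T zero) f x)) (apply-sum (T ∘ suc) f x)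

  ^ᵒ-suc : ∀ F k → F ^ᵒ suc k ≈ F ^ᵒ k ⊛ F
  ^ᵒ-suc F zero    f x = refl
  ^ᵒ-suc F (suc k) f x = apply-cong F (^ᵒ-suc F k f) x

  shift : (X → X) → Operator
  shift s = record { apply = λ f → f ∘ s ; apply-cong = λ e → e ∘ s ; apply-+ = λ _ _ _ → refl ; apply-0 = λ _ → refl }

  shiftSum : ∀ {m} → (Fin m → X → X) → Operator
  shiftSum {m} t = record
    { apply      = λ f x → sum (λ i → f (t i x))
    ; apply-cong = λ e x → sum-cong-≗ (λ i → e (t i x))
    ; apply-+    = λ f g x → ∑-distrib-+ (λ i → f (t i x)) (λ i → g (t i x))
    ; apply-0    = λ _ → sum-zero m
    }

  iterate : (X → X) → ℕ → X → X
  iterate s zero    x = x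
  iterate s (suc k) x = iterate s k (s x)

  apply-shift^ : ∀ s k g x → apply (shift s ^ᵒ k) g x ≡ g (iterate s k x)
  apply-shift^ s zero    g x = refl
  apply-shift^ s (suc k) g x = apply-shift^ s k g (s x)

  shiftSum-const : ∀ {m} (t : Fin m → X → X) k c x → apply (shiftSum t ^ᵒ k) (λ _ → c) x ≡ + (m ℕ.^ k) * c
  shiftSum-const {m} t zero    c x = sym (ℤₚ.*-identityˡ c)
  shiftSum-const {m} t (suc k) c x = begin
    sum (λ i → apply (shiftSum t ^ᵒ k) (λ _ → c) (t i x)) ≡⟨ sum-cong-≗ (λ i → shiftSum-const t k c (t i x)) ⟩
    sum {m} (λ _ → + (m ℕ.^ k) * c)                       ≡⟨ sum-const m (+ (m ℕ.^ k) * c) ⟩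
    + m * (+ (m ℕ.^ k) * c)                              ≡⟨ ℤₚ.*-assoc (+ m) (+ (m ℕ.^ k)) c ⟨
    + m * + (m ℕ.^ k) * c                                ≡⟨ cong (_* c) (ℤₚ.pos-* m (m ℕ.^ k)) ⟨
    + (m ℕ.^ suc k) * c                                  ∎
    where open ≡-Reasoning

  module Frobenius (q : ℕ) (p-prime : Prime (suc q)) where
    open PrimeModulus q p-prime

    freshmans-dream : ∀ F G → F ⊛ G ≈ G ⊛ F → ∀ f x →
                      apply ((F ⊕ G) ^ᵒ p) f x ≡ₚ apply (G ^ᵒ p) f x + apply (F ^ᵒ p) f x
    freshmans-dream F G FG≈GF f x = begin
      apply ((F ⊕ G) ^ᵒ p) f x               ≡⟨ theorem FG≈GF p f x ⟩
      apply (binomialExpansion p) f x        ≡⟨ apply-sum (binomialTerm p) f x ⟩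
      sum (λ k → apply (binomialTerm p k) f x) ≡⟨ sum-cong-≗ (λ k → apply-× (p C toℕ k) (binomial p k) f x) ⟩
      sum {suc p} (λ k → term (toℕ k))       ≈⟨ ≡ₚ-+ (≡ₚ-refl {term 0}) (sum-≡ₚ-last {q} (λ k → term (suc (toℕ k))) middle≡0) ⟩
      term 0 + term (suc (toℕ (fromℕ q)))    ≡⟨ cong₂ _+_ first (trans (cong (term ∘ suc) (Finₚ.toℕ-fromℕ q)) last) ⟩
      apply (G ^ᵒ p) f x + apply (F ^ᵒ p) f x ∎
      where
      open ≡ₚ-Reasoning
      open import Algebra.Properties.Semiring.Binomial operator-semiring F G using (theorem; binomial; binomialExpansion; binomialTerm)
      term : ℕ → ℤ
      term k = + (p C k) * apply (F ^ᵒ k ⊛ G ^ᵒ (p ∸ k)) f x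
      middle≡0 : ∀ (i : Fin q) → term (suc (toℕ (Fin.inject₁ i))) ≡ₚ 0ℤ
      middle≡0 i = multiple≡ₚ0 (p C suc (toℕ (Fin.inject₁ i))) (apply (F ^ᵒ suc (toℕ (Fin.inject₁ i)) ⊛ G ^ᵒ (p ∸ suc (toℕ (Fin.inject₁ i)))) f x) (prime∣pCk p-prime (suc (toℕ (Fin.inject₁ i))) (s≤s z≤n)
                                     (s≤s (subst (ℕ._< q) (sym (Finₚ.toℕ-inject₁ i)) (Finₚ.toℕ<n i))))
      first : term 0 ≡ apply (G ^ᵒ p) f x
      first = ℤₚ.*-identityˡ (apply (G ^ᵒ p) f x)
      last : term p ≡ apply (F ^ᵒ p) f x
      last = trans (cong₂ (λ c e → + c * apply (F ^ᵒ p ⊛ G ^ᵒ e) f x) (nCn≡1 p) (ℕₚ.n∸n≡0 p)) (ℤₚ.*-identityˡ (apply (F ^ᵒ p) f x))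

    frobenius : ∀ {m} (t : Fin m → X → X) → (∀ i j x → t i (t j x) ≡ t j (t i x)) →
                ∀ f x → apply (shiftSum t ^ᵒ p) f x ≡ₚ sum (λ i → f (iterate (t i) p x))
    frobenius {zero}  t commute f x = ≡ₚ-refl
    frobenius {suc m} t commute f x = begin
      apply (shiftSum t ^ᵒ p) f x
        ≡⟨ ^-congˡ p {shiftSum t} {shift (t zero) ⊕ shiftSum (t ∘ suc)} (λ _ _ → refl) f x ⟩
      apply ((shift (t zero) ⊕ shiftSum (t ∘ suc)) ^ᵒ p) f x
        ≈⟨ freshmans-dream (shift (t zero)) (shiftSum (t ∘ suc)) (λ g y → sum-cong-≗ (λ i → cong g (commute (suc i) zero y))) f x ⟩
      apply (shiftSum (t ∘ suc) ^ᵒ p) f x + apply (shift (t zero) ^ᵒ p) f x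
        ≈⟨ ≡ₚ-+ (frobenius (t ∘ suc) (λ i j → commute (suc i) (suc j)) f x) (≡⇒≡ₚ (apply-shift^ (t zero) p f x)) ⟩
      sum (λ i → f (iterate (t (suc i)) p x)) + f (iterate (t zero) p x)
        ≡⟨ ℤₚ.+-comm (sum (λ i → f (iterate (t (suc i)) p x))) (f (iterate (t zero) p x)) ⟩
      sum (λ i → f (iterate (t i) p x)) ∎
      where
      open ≡ₚ-Reasoning
      open import Algebra.Properties.Semiring.Exp operator-semiring using (^-congˡ)

module Differences (q : ℕ) (p-prime : Prime (suc q)) where
  open PrimeModulus q p-prime
  open Operators ℤ
  open Frobenius q p-prime

  Δ : (ℤ → ℤ) → ℤ → ℤ
  Δ g y = g y - g (y + 1ℤ)

  Δ^ : ℕ → (ℤ → ℤ) → ℤ → ℤ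
  Δ^ zero    g = g
  Δ^ (suc k) g = Δ (Δ^ k g)

  Δ-cong : ∀ {g h} → (∀ y → g y ≡ h y) → ∀ y → Δ g y ≡ Δ h y
  Δ-cong g≗h y = cong₂ _-_ (g≗h y) (g≗h (y + 1ℤ))

  Δ^-cong : ∀ k {g h} → (∀ y → g y ≡ h y) → ∀ y → Δ^ k g y ≡ Δ^ k h y
  Δ^-cong zero    g≗h = g≗h
  Δ^-cong (suc k) g≗h = Δ-cong (Δ^-cong k g≗h)

  Δ^-suc′ : ∀ k g y → Δ^ (suc k) g y ≡ Δ^ k (Δ g) y
  Δ^-suc′ zero    g y = refl
  Δ^-suc′ (suc k) g y = Δ-cong (Δ^-suc′ k g) y

  Δ-+const : ∀ h m y → Δ (λ z → h z + m) y ≡ Δ h y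
  Δ-+const h m y = lemma (h y) (h (y + 1ℤ)) m
    where lemma : ∀ a b m → a + m - (b + m) ≡ a - b
          lemma = solve-∀

  -- Since -1 ≡ q (mod p), Δ f y ≡ f y + q · f (y + 1): Δ is the shift sum over t₀ = id, t₁ = ⋯ = t_q = (_+ 1).
  private
    steps : Fin p → ℤ → ℤ
    steps zero    y = y
    steps (suc _) y = y + 1ℤ

    steps-commute : ∀ i j y → steps i (steps j y) ≡ steps j (steps i y)
    steps-commute zero    zero    y = refl
    steps-commute zero    (suc _) y = refl
    steps-commute (suc _) zero    y = refl
    steps-commute (suc _) (suc _) y = refl

    iterate-steps₀ : ∀ k y → iterate (steps zero) k y ≡ y
    iterate-steps₀ zero    y = refl
    iterate-steps₀ (suc k) y = iterate-steps₀ k y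

    iterate-steps₁ : ∀ (i : Fin q) k y → iterate (steps (suc i)) k y ≡ y + + k
    iterate-steps₁ i zero    y = sym (ℤₚ.+-identityʳ y)
    iterate-steps₁ i (suc k) y = trans (iterate-steps₁ i k (y + 1ℤ)) (trans (lemma y (+ k)) (cong (_+_ y) (sym (pos-suc k))))
      where lemma : ∀ y k → y + 1ℤ + k ≡ y + (1ℤ + k)
            lemma = solve-∀

  Δ^≡ₚshiftSum : ∀ k g y → Δ^ k g y ≡ₚ apply (shiftSum steps ^ᵒ k) g y
  Δ^≡ₚshiftSum zero    g y = ≡ₚ-refl
  Δ^≡ₚshiftSum (suc k) g y = begin
    Δ^ k g y - Δ^ k g (y + 1ℤ)         ≈⟨ ≡ₚ-- (Δ^≡ₚshiftSum k g y) (Δ^≡ₚshiftSum k g (y + 1ℤ)) ⟩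
    H y - H (y + 1ℤ)                   ≈⟨ a+kP≡ₚa (H (y + 1ℤ)) (H y - H (y + 1ℤ)) ⟨
    H y - H (y + 1ℤ) + H (y + 1ℤ) * P  ≡⟨ lemma (H y) (H (y + 1ℤ)) (+ q) ⟩
    H y + + q * H (y + 1ℤ)             ≡⟨ cong (_+_ (H y)) (sum-const q (H (y + 1ℤ))) ⟨
    apply (shiftSum steps) H y         ∎
    where
    open ≡ₚ-Reasoning
    H = apply (shiftSum steps ^ᵒ k) g
    lemma : ∀ a b q → a - b + b * (1ℤ + q) ≡ a + q * b
    lemma = solve-∀

  Δ^p≡ₚ0 : ∀ g → Periodic g → ∀ y → Δ^ p g y ≡ₚ 0ℤ
  Δ^p≡ₚ0 g g-periodic y = begin
    Δ^ p g y                                     ≈⟨ Δ^≡ₚshiftSum p g y ⟩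
    apply (shiftSum steps ^ᵒ p) g y              ≈⟨ frobenius steps steps-commute g y ⟩
    sum (λ i → g (iterate (steps i) p y))        ≡⟨ cong₂ _+_ (cong g (iterate-steps₀ p y))
                                                          (sum-cong-≗ λ i → cong g (iterate-steps₁ i p y)) ⟩
    g y + sum {q} (λ _ → g (y + P))              ≡⟨ cong (_+_ (g y)) (trans (sum-const q (g (y + P))) (cong (+ q *_) (g-periodic y+P≡ₚy))) ⟩
    g y + + q * g y                              ≡⟨ lemma (g y) (+ q) ⟩
    0ℤ + g y * P                                 ≈⟨ a+kP≡ₚa (g y) 0ℤ ⟩
    0ℤ                                           ∎
    where
    open ≡ₚ-Reasoning
    y+P≡ₚy : y + P ≡ₚ y
    y+P≡ₚy = subst (_≡ₚ y) (cong (_+_ y) (ℤₚ.*-identityˡ P)) (a+kP≡ₚa 1ℤ y)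
    lemma : ∀ a q → a + q * a ≡ 0ℤ + a * (1ℤ + q)
    lemma = solve-∀

  sum-telescope : ∀ m (F : ℕ → ℤ) → F 0 + sum {m} (λ j → F (suc (toℕ j))) ≡ sum {m} (λ j → F (toℕ j)) + F m
  sum-telescope m F = trans (sum-init-last {m} (λ j → F (toℕ j)))
                            (cong₂ _+_ (sum-cong-≗ {m} (cong F ∘ Finₚ.toℕ-inject₁)) (cong F (Finₚ.toℕ-fromℕ m)))

  step-invariant⇒constant : ∀ {Q} → Periodic Q → (∀ y → Q y ≡ₚ Q (y + 1ℤ)) → ∀ y → Q y ≡ₚ Q 0ℤ
  step-invariant⇒constant {Q} Q-periodic step y =
    subst (_≡ₚ Q 0ℤ) (Q-periodic (⟪residue⟫ y)) (on-ℕ (toℕ (residue y)))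
    where on-ℕ : ∀ k → Q (+ k) ≡ₚ Q 0ℤ
          on-ℕ zero    = ≡ₚ-refl
          on-ℕ (suc k) = ≡ₚ-trans (≡ₚ-sym (subst (λ z → Q (+ k) ≡ₚ Q z) (ℤₚ.+-comm (+ k) 1ℤ) (step (+ k)))) (on-ℕ k)

  divide-by-P : ∀ (f : ℤ → ℤ) → (∀ y → f y ≡ₚ 0ℤ) → ∃ λ (g : ℤ → ℤ) → ∀ y → f y ≡ P * g y
  divide-by-P f f≡0 = (λ y → quotient (divides-difference (f≡0 y))) , λ y → multiple (divides-difference (f≡0 y))
    where multiple : ∀ {a} (d : P ∣ a - 0ℤ) → a ≡ P * quotient d
          multiple {a} d = trans (sym (ℤₚ.+-identityʳ a)) (trans (_∣_.equality d) (ℤₚ.*-comm (quotient d) P))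

  quotient-periodic : ∀ {f g c} → Periodic f → (∀ y → f y ≡ P * g y + c) → Periodic g
  quotient-periodic {f} {g} {c} f-periodic f≡Pg+c {a} {b} a≡b =
    P*-cancel (+-cancelʳ-≡ (P * g a) (P * g b) c (trans (sym (f≡Pg+c a)) (trans (f-periodic a≡b) (f≡Pg+c b))))

  Δ-periodic : ∀ {g} → Periodic g → Periodic (Δ g)
  Δ-periodic g-periodic a≡b = cong₂ _-_ (g-periodic a≡b) (g-periodic (≡ₚ-+ a≡b ≡ₚ-refl))

  module Moment {h : ℤ → ℤ} (h-periodic : Periodic h) where

    moment : ℤ → ℤ
    moment y = sum {p} (λ j → ⟪ j ⟫ * h (y + ⟪ j ⟫))

    moment-periodic : Periodic moment
    moment-periodic a≡b = sum-cong-≗ {p} λ j → cong (⟪ j ⟫ *_) (h-periodic (≡ₚ-+ a≡b (≡ₚ-refl {⟪ j ⟫})))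

    private
      term : ℤ → ℕ → ℤ
      term y k = + k * h (y + + k)

      term-suc : ∀ y k → term y (suc k) ≡ + k * h (y + 1ℤ + + k) + h (+ k + (y + 1ℤ))
      term-suc y k = begin
        (1ℤ + + k) * h (y + (1ℤ + + k))              ≡⟨ cong (λ z → (1ℤ + + k) * h z) (ℤₚ.+-assoc y 1ℤ (+ k)) ⟨
        (1ℤ + + k) * h (y + 1ℤ + + k)                ≡⟨ lemma (+ k) (h (y + 1ℤ + + k)) ⟩
        + k * h (y + 1ℤ + + k) + h (y + 1ℤ + + k)    ≡⟨ cong (λ z → + k * h (y + 1ℤ + + k) + h z) (ℤₚ.+-comm (y + 1ℤ) (+ k)) ⟩
        + k * h (y + 1ℤ + + k) + h (+ k + (y + 1ℤ))  ∎
        where open ≡-Reasoning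
              lemma : ∀ k a → (1ℤ + k) * a ≡ k * a + a
              lemma = solve-∀

    moment-shift : ∀ y → moment (y + 1ℤ) + total h ≡ moment y + P * h y
    moment-shift y = begin
      moment (y + 1ℤ) + total h
        ≡⟨ cong (_+_ (moment (y + 1ℤ))) (sum-translate h h-periodic (y + 1ℤ)) ⟨
      moment (y + 1ℤ) + sum {p} (λ j → h (⟪ j ⟫ + (y + 1ℤ)))
        ≡⟨ ∑-distrib-+ (λ j → ⟪ j ⟫ * h (y + 1ℤ + ⟪ j ⟫)) (λ j → h (⟪ j ⟫ + (y + 1ℤ))) ⟨
      sum {p} (λ j → ⟪ j ⟫ * h (y + 1ℤ + ⟪ j ⟫) + h (⟪ j ⟫ + (y + 1ℤ)))
        ≡⟨ sum-cong-≗ {p} (λ j → term-suc y (toℕ j)) ⟨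
      sum {p} (λ j → term y (suc (toℕ j)))
        ≡⟨ ℤₚ.+-identityˡ (sum {p} (λ j → term y (suc (toℕ j)))) ⟨
      0ℤ + sum {p} (λ j → term y (suc (toℕ j)))
        ≡⟨ cong (_+ sum {p} (λ j → term y (suc (toℕ j)))) (ℤₚ.*-zeroˡ (h (y + 0ℤ))) ⟨
      term y 0 + sum {p} (λ j → term y (suc (toℕ j)))
        ≡⟨ sum-telescope p (term y) ⟩
      moment y + P * h (y + P)
        ≡⟨ cong (λ z → moment y + P * z) (h-periodic y+P≡ₚy) ⟩
      moment y + P * h y
        ∎
      where open ≡-Reasoning
            y+P≡ₚy : y + P ≡ₚ y
            y+P≡ₚy = subst (_≡ₚ y) (cong (_+_ y) (ℤₚ.*-identityˡ P)) (a+kP≡ₚa 1ℤ y)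

  antidifference-of-potential : ∀ {Q h : ℤ → ℤ} {m} → Periodic Q → (∀ y → Q (y + 1ℤ) - Q y ≡ P * (h y - m)) →
                                ∃ λ (h′ : ℤ → ℤ) → Periodic h′ × ∀ y → h y ≡ Δ h′ y + m
  antidifference-of-potential {Q} {h} {m} Q-periodic ΔQ≡P[h-m] = h′ , h′-periodic , h≡Δh′+m
    where
    Q0-Q≡ₚ0 : ∀ y → Q 0ℤ - Q y ≡ₚ 0ℤ
    Q0-Q≡ₚ0 y = ≡ₚ-trans (≡ₚ-- (≡ₚ-refl {Q 0ℤ}) (step-invariant⇒constant Q-periodic step y)) (≡⇒≡ₚ (ℤₚ.+-inverseʳ (Q 0ℤ)))
      where step : ∀ y → Q y ≡ₚ Q (y + 1ℤ)
            step y = ≡ₚ-sym {Q (y + 1ℤ)} {Q y} (mk (divides (h y - m) (trans (ΔQ≡P[h-m] y) (ℤₚ.*-comm P (h y - m)))))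

    h′ : ℤ → ℤ
    h′ = proj₁ (divide-by-P (λ y → Q 0ℤ - Q y) Q0-Q≡ₚ0)

    Q0-Q≡Ph′ : ∀ y → Q 0ℤ - Q y ≡ P * h′ y
    Q0-Q≡Ph′ = proj₂ (divide-by-P (λ y → Q 0ℤ - Q y) Q0-Q≡ₚ0)

    h′-periodic : Periodic h′
    h′-periodic = quotient-periodic {λ y → Q 0ℤ - Q y} {h′} {0ℤ} (λ a≡b → cong (_-_ (Q 0ℤ)) (Q-periodic a≡b))
                                    (λ y → trans (Q0-Q≡Ph′ y) (sym (ℤₚ.+-identityʳ _)))

    h≡Δh′+m : ∀ y → h y ≡ Δ h′ y + m
    h≡Δh′+m y = lemma (h y) m (Δ h′ y) (P*-cancel {h y - m} {Δ h′ y} (begin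
      P * (h y - m)                       ≡⟨ ΔQ≡P[h-m] y ⟨
      Q (y + 1ℤ) - Q y                    ≡⟨ lemma′ (Q 0ℤ) (Q y) (Q (y + 1ℤ)) ⟩
      (Q 0ℤ - Q y) - (Q 0ℤ - Q (y + 1ℤ))  ≡⟨ cong₂ _-_ (Q0-Q≡Ph′ y) (Q0-Q≡Ph′ (y + 1ℤ)) ⟩
      P * h′ y - P * h′ (y + 1ℤ)          ≡⟨ lemma″ P (h′ y) (h′ (y + 1ℤ)) ⟩
      P * Δ h′ y                          ∎))
      where open ≡-Reasoning
            lemma : ∀ a m d → a - m ≡ d → a ≡ d + m
            lemma a m d e = trans (lemma‴ a m) (cong (_+ m) e)
              where lemma‴ : ∀ a m → a ≡ a - m + m
                    lemma‴ = solve-∀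
            lemma′ : ∀ a b c → c - b ≡ (a - b) - (a - c)
            lemma′ = solve-∀
            lemma″ : ∀ P a b → P * a - P * b ≡ P * (a - b)
            lemma″ = solve-∀

  antidifference : ∀ h → Periodic h → total h ≡ₚ 0ℤ →
                   ∃ λ (h′ : ℤ → ℤ) → Periodic h′ × ∃ λ m → ∀ y → h y ≡ Δ h′ y + m
  antidifference h h-periodic (mk (divides m total-0≡mP)) = proj₁ r , proj₁ (proj₂ r) , m , proj₂ (proj₂ r)
    where
    open Moment h-periodic
    r = antidifference-of-potential {moment} {h} {m} moment-periodic λ y →
          lemma (moment (y + 1ℤ)) (moment y) (total h) (h y) m P (moment-shift y) (trans (sym (ℤₚ.+-identityʳ (total h))) total-0≡mP)
      where lemma : ∀ a b s c m P → a + s ≡ b + P * c → s ≡ m * P → a - b ≡ P * (c - m)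
            lemma a b s c m P e₁ e₂ = begin
              a - b                    ≡⟨ lemma₁ a b s ⟩
              (a + s) - s - b          ≡⟨ cong₂ (λ x z → x - z - b) e₁ e₂ ⟩
              b + P * c - m * P - b    ≡⟨ lemma₂ b P c m ⟩
              P * (c - m)              ∎
              where open ≡-Reasoning
                    lemma₁ : ∀ a b s → a - b ≡ (a + s) - s - b
                    lemma₁ = solve-∀
                    lemma₂ : ∀ b P c m → b + P * c - m * P - b ≡ P * (c - m)
                    lemma₂ = solve-∀

  Δ^-antidifference : ∀ k {g g′ m} → (∀ y → g y ≡ Δ g′ y + m) → ∀ y → Δ^ (suc k) g y ≡ Δ^ (suc (suc k)) g′ y
  Δ^-antidifference k {g} {g′} {m} g≡Δg′+m y = begin
    Δ^ (suc k) g y          ≡⟨ Δ^-suc′ k g y ⟩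
    Δ^ k (Δ g) y            ≡⟨ Δ^-cong k (λ z → trans (Δ-cong g≡Δg′+m z) (Δ-+const (Δ g′) m z)) y ⟩
    Δ^ k (Δ (Δ g′)) y       ≡⟨ Δ^-suc′ k (Δ g′) y ⟨
    Δ^ (suc k) (Δ g′) y     ≡⟨ Δ^-suc′ (suc k) g′ y ⟨
    Δ^ (suc (suc k)) g′ y   ∎
    where open ≡-Reasoning

  oscillation : (ℤ → ℤ) → ℕ
  oscillation f = ℕΣ.sum {p} (λ c → ∣ f ⟪ c ⟫ - f 0ℤ ∣)

  oscillation-scale : ∀ {f g c} → (∀ y → f y ≡ P * g y + c) → oscillation f ≡ oscillation g ℕ.* p
  oscillation-scale {f} {g} {c} f≡Pg+c =
    trans (ℕΣ.sum-cong-≗ {p} term) (sym (ℕΣ.*-distribʳ-sum p (λ d → ∣ g ⟪ d ⟫ - g 0ℤ ∣)))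
    where
    term : ∀ d → ∣ f ⟪ d ⟫ - f 0ℤ ∣ ≡ ∣ g ⟪ d ⟫ - g 0ℤ ∣ ℕ.* p
    term d = trans (cong ∣_∣ (trans (cong₂ _-_ (f≡Pg+c ⟪ d ⟫) (f≡Pg+c 0ℤ)) (lemma P (g ⟪ d ⟫) (g 0ℤ) c)))
                   (ℤₚ.∣i*j∣≡∣i∣*∣j∣ (g ⟪ d ⟫ - g 0ℤ) P)
      where lemma : ∀ P a b c → P * a + c - (P * b + c) ≡ (a - b) * P
            lemma = solve-∀

  ¬constant⇒oscillation>0 : ∀ {f} → ¬ Constant f → 0 ℕ.< oscillation f
  ¬constant⇒oscillation>0 {f} ¬const with Finₚ.¬∀⟶∃¬ p _ (λ c → f ⟪ c ⟫ ℤ.≟ f 0ℤ) ¬const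
  ... | c , fc≢f0 = ℕₚ.<-≤-trans (nonzero (fc≢f0 ∘ ℤₚ.i-j≡0⇒i≡j _ _)) (ℕsum-≥ (λ d → ∣ f ⟪ d ⟫ - f 0ℤ ∣) c)
    where nonzero : ∀ {z} → z ≢ 0ℤ → 0 ℕ.< ∣ z ∣
          nonzero {+ zero}   z≢0 = ⊥-elim (z≢0 refl)
          nonzero {+ suc _}  _   = s≤s z≤n
          nonzero { -[1+ _ ]} _   = s≤s z≤n

  oscillation-decreases : ∀ {f g c} → (∀ y → f y ≡ P * g y + c) → ¬ Constant f → oscillation g ℕ.< oscillation f
  oscillation-decreases {f} {g} {c} f≡Pg+c ¬f-const =
    subst (oscillation g ℕ.<_) (sym osc-f≡osc-g*p) (lemma (oscillation g) (subst (0 ℕ.<_) osc-f≡osc-g*p (¬constant⇒oscillation>0 {f} ¬f-const)))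
    where osc-f≡osc-g*p : oscillation f ≡ oscillation g ℕ.* p
          osc-f≡osc-g*p = oscillation-scale {f} {g} {c} f≡Pg+c
          lemma : ∀ a → 0 ℕ.< a ℕ.* p → a ℕ.< a ℕ.* p
          lemma (suc a) _ = ℕₚ.m<m*n (suc a) p 1<p

  constant-scale : ∀ {f g c} → (∀ y → f y ≡ P * g y + c) → Constant g → Constant f
  constant-scale {f} {g} {c} f≡Pg+c g-const d =
    trans (f≡Pg+c ⟪ d ⟫) (trans (cong (λ z → P * z + c) (g-const d)) (sym (f≡Pg+c 0ℤ)))

  -- Φ f forces total f ≡ 0, so f can be antidifferenced q times; as Δᵖ ≡ 0 (mod p) this makes f constant mod p,
  -- i.e. f = p g + f 0 with Φ g and the oscillation of g p times smaller than that of f.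
  module Descent (Φ : (ℤ → ℤ) → Set)
    (total≡ₚ0        : ∀ {f} → Periodic f → Φ f → total f ≡ₚ 0ℤ)
    (Φ-antidifference : ∀ {f f′ m} → Periodic f′ → (∀ y → f y ≡ Δ f′ y + m) → Φ f → Φ f′)
    (Φ-quotient       : ∀ {f g c} → Periodic g → (∀ y → f y ≡ P * g y + c) → Φ f → Φ g)
    where

    record Chain (f : ℤ → ℤ) (k : ℕ) : Set where
      field
        g          : ℤ → ℤ
        g-periodic : Periodic g
        Φg         : Φ g
        Δf≡Δ^g     : ∀ y → Δ f y ≡ Δ^ (suc k) g y

    chain : ∀ {f} → Periodic f → Φ f → ∀ k → Chain f k
    chain {f} f-periodic Φf zero    = record { g = f ; g-periodic = f-periodic ; Φg = Φf ; Δf≡Δ^g = λ _ → refl }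
    chain {f} f-periodic Φf (suc k) = extend (chain f-periodic Φf k)
      where
      extend : Chain f k → Chain f (suc k)
      extend c = record
        { g          = g′
        ; g-periodic = g′-periodic
        ; Φg         = Φ-antidifference {g} {g′} {m} g′-periodic g≡Δg′+m Φg
        ; Δf≡Δ^g     = λ y → trans (Δf≡Δ^g y) (Δ^-antidifference k {g} {g′} {m} g≡Δg′+m y)
        }
        where
        open Chain c
        antiderivative = antidifference g g-periodic (total≡ₚ0 g-periodic Φg)
        g′ : ℤ → ℤ
        g′ = proj₁ antiderivative
        g′-periodic : Periodic g′
        g′-periodic = proj₁ (proj₂ antiderivative)
        m : ℤ
        m = proj₁ (proj₂ (proj₂ antiderivative))
        g≡Δg′+m : ∀ y → g y ≡ Δ g′ y + m
        g≡Δg′+m = proj₂ (proj₂ (proj₂ antiderivative))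

    step-invariant : ∀ {f} → Periodic f → Φ f → ∀ y → f y ≡ₚ f (y + 1ℤ)
    step-invariant {f} f-periodic Φf y = begin
      f y                     ≡⟨ lemma (f y) (f (y + 1ℤ)) ⟩
      Δ f y + f (y + 1ℤ)      ≡⟨ cong (_+ f (y + 1ℤ)) (Δf≡Δ^g y) ⟩
      Δ^ p g y + f (y + 1ℤ)   ≈⟨ ≡ₚ-+ (Δ^p≡ₚ0 g g-periodic y) ≡ₚ-refl ⟩
      0ℤ + f (y + 1ℤ)         ≡⟨ ℤₚ.+-identityˡ (f (y + 1ℤ)) ⟩
      f (y + 1ℤ)              ∎
      where open Chain (chain f-periodic Φf q)
            open ≡ₚ-Reasoning
            lemma : ∀ a b → a ≡ a - b + b
            lemma = solve-∀

    quotient-step : ∀ {f} → Periodic f → Φ f → ∃ λ g → Periodic g × Φ g × (∀ y → f y ≡ P * g y + f 0ℤ)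
    quotient-step {f} f-periodic Φf = g , g-periodic , Φ-quotient {f} {g} {f 0ℤ} g-periodic f≡Pg+f0 Φf , f≡Pg+f0
      where
      f-f0≡ₚ0 : ∀ y → f y - f 0ℤ ≡ₚ 0ℤ
      f-f0≡ₚ0 y = ≡ₚ-trans (≡ₚ-- (step-invariant⇒constant {f} f-periodic (step-invariant f-periodic Φf) y) (≡ₚ-refl {f 0ℤ}))
                           (≡⇒≡ₚ (ℤₚ.+-inverseʳ (f 0ℤ)))
      g : ℤ → ℤ
      g = proj₁ (divide-by-P (λ y → f y - f 0ℤ) f-f0≡ₚ0)
      f≡Pg+f0 : ∀ y → f y ≡ P * g y + f 0ℤ
      f≡Pg+f0 y = trans (lemma (f y) (f 0ℤ)) (cong (_+ f 0ℤ) (proj₂ (divide-by-P (λ y → f y - f 0ℤ) f-f0≡ₚ0) y))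
        where lemma : ∀ a b → a ≡ a - b + b
              lemma = solve-∀
      g-periodic : Periodic g
      g-periodic = quotient-periodic {f} {g} {f 0ℤ} f-periodic f≡Pg+f0

    descent-with-fuel : ∀ N {f} → oscillation f ℕ.< N → Periodic f → Φ f → Constant f
    descent-with-fuel (suc N) {f} osc<N f-periodic Φf = decide (Constant? f)
      where
      decide : Dec (Constant f) → Constant f
      decide (yes f-const) = f-const
      decide (no ¬f-const) =
        constant-scale {f} {g} {f 0ℤ} f≡Pg+f0 (descent-with-fuel N osc<N′ g-periodic Φg)
        where
        step = quotient-step f-periodic Φf
        g : ℤ → ℤ
        g = proj₁ step
        g-periodic : Periodic g
        g-periodic = proj₁ (proj₂ step)
        Φg : Φ g
        Φg = proj₁ (proj₂ (proj₂ step))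
        f≡Pg+f0 : ∀ y → f y ≡ P * g y + f 0ℤ
        f≡Pg+f0 = proj₂ (proj₂ (proj₂ step))
        osc<N′ : oscillation g ℕ.< N
        osc<N′ = ℕₚ.<-≤-trans (oscillation-decreases {f} {g} {f 0ℤ} f≡Pg+f0 ¬f-const) (ℕₚ.≤-pred osc<N)

    descent : ∀ {f} → Periodic f → Φ f → Constant f
    descent {f} = descent-with-fuel (suc (oscillation f)) (ℕₚ.n<1+n (oscillation f))

module Convolution (q : ℕ) (p-prime : Prime (suc q)) where
  open PrimeModulus q p-prime
  open Differences q p-prime

  -- A periodic function is an element of ℤ[ℤ/p] and ⋆ is its product; Constant f means f ∈ ℤ · (1 + x + ⋯ + xᵖ⁻¹).
  infixl 7 _⋆_
  _⋆_ : (ℤ → ℤ) → (ℤ → ℤ) → ℤ → ℤ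
  (a ⋆ e) x = sum {p} (λ c → a ⟪ c ⟫ * e (x - ⟪ c ⟫))

  ⋆-periodic : ∀ a {e} → Periodic e → Periodic (a ⋆ e)
  ⋆-periodic a e-periodic x≡y = sum-cong-≗ {p} λ c → cong (a ⟪ c ⟫ *_) (e-periodic (≡ₚ-- x≡y (≡ₚ-refl {⟪ c ⟫})))

  total-⋆ : ∀ a {e} → Periodic e → total (a ⋆ e) ≡ total a * total e
  total-⋆ a {e} e-periodic = begin
    sum (λ x → sum (λ c → a ⟪ c ⟫ * e (⟪ x ⟫ - ⟪ c ⟫)))  ≡⟨ ∑-comm (λ x c → a ⟪ c ⟫ * e (⟪ x ⟫ - ⟪ c ⟫)) ⟩
    sum (λ c → sum (λ x → a ⟪ c ⟫ * e (⟪ x ⟫ - ⟪ c ⟫)))  ≡⟨ sum-cong-≗ {p} inner ⟩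
    sum (λ c → a ⟪ c ⟫ * total e)                          ≡⟨ *-distribʳ-sum (total e) (λ c → a ⟪ c ⟫) ⟨
    total a * total e                                      ∎
    where
    open ≡-Reasoning
    inner : ∀ c → sum {p} (λ x → a ⟪ c ⟫ * e (⟪ x ⟫ - ⟪ c ⟫)) ≡ a ⟪ c ⟫ * total e
    inner c = trans (sym (*-distribˡ-sum (a ⟪ c ⟫) (λ x → e (⟪ x ⟫ - ⟪ c ⟫))))
                    (cong (a ⟪ c ⟫ *_) (sum-translate e e-periodic (- ⟪ c ⟫)))

  ⋆-comm : ∀ {a e} → Periodic a → Periodic e → ∀ x → (a ⋆ e) x ≡ (e ⋆ a) x
  ⋆-comm {a} {e} a-periodic e-periodic x =
    trans (sum-cong-≗ {p} λ c → trans (ℤₚ.*-comm (a ⟪ c ⟫) (e (x - ⟪ c ⟫)))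
                                       (cong₂ _*_ (cong e (lemma₁ x ⟪ c ⟫)) (cong a (lemma₂ x ⟪ c ⟫))))
          (sum-affine h h-periodic (- 1ℤ) x (1≢ₚ0 ∘ ≡ₚ-neg))
    where
    h : ℤ → ℤ
    h d = e d * a (x - d)
    h-periodic : Periodic h
    h-periodic d≡d′ = cong₂ _*_ (e-periodic d≡d′) (a-periodic (≡ₚ-- (≡ₚ-refl {x}) d≡d′))
    lemma₁ : ∀ x c → x - c ≡ - 1ℤ * c + x
    lemma₁ = solve-∀
    lemma₂ : ∀ x c → c ≡ x - (- 1ℤ * c + x)
    lemma₂ = solve-∀

  ⋆-antidifference : ∀ b {e e′ m} → (∀ y → e y ≡ Δ e′ y + m) → ∀ x → (b ⋆ e) x ≡ Δ (b ⋆ e′) x + m * total b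
  ⋆-antidifference b {e} {e′} {m} e≡Δe′+m x = begin
    sum (λ c → b ⟪ c ⟫ * e (x - ⟪ c ⟫))
      ≡⟨ sum-cong-≗ {p} term ⟩
    sum (λ c → (b ⟪ c ⟫ * e′ (x - ⟪ c ⟫) - b ⟪ c ⟫ * e′ (x + 1ℤ - ⟪ c ⟫)) + m * b ⟪ c ⟫)
      ≡⟨ ∑-distrib-+ (λ c → b ⟪ c ⟫ * e′ (x - ⟪ c ⟫) - b ⟪ c ⟫ * e′ (x + 1ℤ - ⟪ c ⟫)) (λ c → m * b ⟪ c ⟫) ⟩
    sum (λ c → b ⟪ c ⟫ * e′ (x - ⟪ c ⟫) - b ⟪ c ⟫ * e′ (x + 1ℤ - ⟪ c ⟫)) + sum (λ c → m * b ⟪ c ⟫)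
      ≡⟨ cong₂ _+_ (∑-distrib-- (λ c → b ⟪ c ⟫ * e′ (x - ⟪ c ⟫)) (λ c → b ⟪ c ⟫ * e′ (x + 1ℤ - ⟪ c ⟫)))
                   (sym (*-distribˡ-sum m (λ c → b ⟪ c ⟫))) ⟩
    Δ (b ⋆ e′) x + m * total b
      ∎
    where
    open ≡-Reasoning
    lemma₁ : ∀ x c → x - c + 1ℤ ≡ x + 1ℤ - c
    lemma₁ = solve-∀
    lemma₂ : ∀ b u w m → b * (u - w + m) ≡ b * u - b * w + m * b
    lemma₂ = solve-∀
    term : ∀ c → b ⟪ c ⟫ * e (x - ⟪ c ⟫) ≡ (b ⟪ c ⟫ * e′ (x - ⟪ c ⟫) - b ⟪ c ⟫ * e′ (x + 1ℤ - ⟪ c ⟫)) + m * b ⟪ c ⟫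
    term c = trans (cong (b ⟪ c ⟫ *_) (trans (e≡Δe′+m (x - ⟪ c ⟫)) (cong (λ z → e′ (x - ⟪ c ⟫) - e′ z + m) (lemma₁ x ⟪ c ⟫))))
                   (lemma₂ (b ⟪ c ⟫) (e′ (x - ⟪ c ⟫)) (e′ (x + 1ℤ - ⟪ c ⟫)) m)

  ⋆-scale : ∀ b {e g c} → (∀ y → e y ≡ P * g y + c) → ∀ x → (b ⋆ e) x ≡ P * (b ⋆ g) x + c * total b
  ⋆-scale b {e} {g} {c} e≡Pg+c x =
    trans (sum-cong-≗ {p} term)
          (trans (∑-distrib-+ (λ d → P * (b ⟪ d ⟫ * g (x - ⟪ d ⟫))) (λ d → c * b ⟪ d ⟫))
                 (cong₂ _+_ (sym (*-distribˡ-sum P (λ d → b ⟪ d ⟫ * g (x - ⟪ d ⟫)))) (sym (*-distribˡ-sum c (λ d → b ⟪ d ⟫)))))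
    where
    lemma : ∀ b g c P → b * (P * g + c) ≡ P * (b * g) + c * b
    lemma = solve-∀
    term : ∀ d → b ⟪ d ⟫ * e (x - ⟪ d ⟫) ≡ P * (b ⟪ d ⟫ * g (x - ⟪ d ⟫)) + c * b ⟪ d ⟫
    term d = trans (cong (b ⟪ d ⟫ *_) (e≡Pg+c (x - ⟪ d ⟫))) (lemma (b ⟪ d ⟫) (g (x - ⟪ d ⟫)) c P)

  antidifference-periodic : ∀ {e e′ m} → Periodic e′ → (∀ y → e y ≡ Δ e′ y + m) → Periodic e
  antidifference-periodic {e} {e′} {m} e′-periodic e≡Δe′+m {a} {b} a≡b =
    trans (e≡Δe′+m a) (trans (cong (_+ m) (Δ-periodic {e′} e′-periodic a≡b)) (sym (e≡Δe′+m b)))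

  scale-periodic : ∀ {f g c} → Periodic g → (∀ y → f y ≡ P * g y + c) → Periodic f
  scale-periodic {f} {g} {c} g-periodic f≡Pg+c {a} {b} a≡b =
    trans (f≡Pg+c a) (trans (cong (λ z → P * z + c) (g-periodic a≡b)) (sym (f≡Pg+c b)))

  Δ-constant⇒constant : ∀ {z} κ → Periodic z → (∀ x → Δ z x ≡ κ) → Constant z
  Δ-constant⇒constant {z} κ z-periodic Δz≡κ c = on-ℕ (toℕ c)
    where
    ∑Δz≡0 : sum {p} (λ x → Δ z ⟪ x ⟫) ≡ 0ℤ
    ∑Δz≡0 = trans (∑-distrib-- (λ x → z ⟪ x ⟫) (λ x → z (⟪ x ⟫ + 1ℤ)))
                  (trans (cong (_-_ (total z)) (sum-translate z z-periodic 1ℤ)) (ℤₚ.+-inverseʳ (total z)))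
    κ≡0 : κ ≡ 0ℤ
    κ≡0 = P*-cancel {κ} {0ℤ} (begin
      P * κ                       ≡⟨ sum-const p κ ⟨
      sum {p} (λ _ → κ)           ≡⟨ sum-cong-≗ {p} (Δz≡κ ∘ ⟪_⟫) ⟨
      sum {p} (λ x → Δ z ⟪ x ⟫)   ≡⟨ ∑Δz≡0 ⟩
      0ℤ                          ≡⟨ ℤₚ.*-zeroʳ P ⟨
      P * 0ℤ                      ∎)
      where open ≡-Reasoning
    on-ℕ : ∀ k → z (+ k) ≡ z 0ℤ
    on-ℕ zero    = refl
    on-ℕ (suc k) = trans (sym (ℤₚ.i-j≡0⇒i≡j (z (+ k)) (z (+ suc k)) Δz≡0)) (on-ℕ k)
      where Δz≡0 : z (+ k) - z (+ suc k) ≡ 0ℤ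
            Δz≡0 = trans (cong (λ y → z (+ k) - z y) (ℤₚ.+-comm 1ℤ (+ k))) (trans (Δz≡κ (+ k)) κ≡0)

  constant-total≡ₚ0 : ∀ {f} → Constant f → total f ≡ₚ 0ℤ
  constant-total≡ₚ0 {f} f-const = ≡ₚ-trans (≡⇒≡ₚ total≡f0*P) (a+kP≡ₚa (f 0ℤ) 0ℤ)
    where total≡f0*P : total f ≡ 0ℤ + f 0ℤ * P
          total≡f0*P = trans (sum-cong-≗ {p} f-const)
                             (trans (sum-const p (f 0ℤ)) (trans (ℤₚ.*-comm P (f 0ℤ)) (sym (ℤₚ.+-identityˡ _))))

  ⋆-constant-comm : ∀ {a e} → Periodic a → Periodic e → Constant (a ⋆ e) → Constant (e ⋆ a)
  ⋆-constant-comm {a} {e} a-periodic e-periodic ae-const d =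
    trans (sym (⋆-comm a-periodic e-periodic ⟪ d ⟫)) (trans (ae-const d) (⋆-comm a-periodic e-periodic 0ℤ))

  ⋆-constant-antidifference : ∀ b {e e′ m} → Periodic e′ → (∀ y → e y ≡ Δ e′ y + m) →
                              Constant (b ⋆ e) → Constant (b ⋆ e′)
  ⋆-constant-antidifference b {e} {e′} {m} e′-periodic e≡Δe′+m be-const =
    Δ-constant⇒constant {b ⋆ e′} ((b ⋆ e) 0ℤ - m * total b) (⋆-periodic b e′-periodic) λ x → begin
      Δ (b ⋆ e′) x                                ≡⟨ lemma (Δ (b ⋆ e′) x) (m * total b) ⟩
      Δ (b ⋆ e′) x + m * total b - m * total b    ≡⟨ cong (_- m * total b) (⋆-antidifference b {e} {e′} {m} e≡Δe′+m x) ⟨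
      (b ⋆ e) x - m * total b                     ≡⟨ cong (_- m * total b) (periodic-constant be-periodic be-const x) ⟩
      (b ⋆ e) 0ℤ - m * total b                    ∎
    where
    open ≡-Reasoning
    be-periodic : Periodic (b ⋆ e)
    be-periodic = ⋆-periodic b (antidifference-periodic {e} {e′} {m} e′-periodic e≡Δe′+m)
    lemma : ∀ a s → a ≡ a + s - s
    lemma = solve-∀

  ⋆-constant-quotient : ∀ b {e g c} → (∀ y → e y ≡ P * g y + c) → Constant (b ⋆ e) → Constant (b ⋆ g)
  ⋆-constant-quotient b {e} {g} {c} e≡Pg+c be-const d =
    P*-cancel {(b ⋆ g) ⟪ d ⟫} {(b ⋆ g) 0ℤ} (+-cancelʳ-≡ _ _ (c * total b)
      (trans (sym (⋆-scale b {e} {g} {c} e≡Pg+c ⟪ d ⟫)) (trans (be-const d) (⋆-scale b {e} {g} {c} e≡Pg+c 0ℤ))))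

  unit-⋆-constant⇒constant : ∀ {b} → ¬ (total b ≡ₚ 0ℤ) → ∀ {e} → Periodic e → Constant (b ⋆ e) → Constant e
  unit-⋆-constant⇒constant {b} total-b≢0 = descent
    where
    total≡ₚ0 : ∀ {f} → Periodic f → Constant (b ⋆ f) → total f ≡ₚ 0ℤ
    total≡ₚ0 {f} f-periodic bf-const =
      [ ⊥-elim ∘ total-b≢0 , id ]′ (euclidₚ (total b) (total f) (subst (_≡ₚ 0ℤ) (total-⋆ b f-periodic) (constant-total≡ₚ0 {b ⋆ f} bf-const)))
    open Descent (λ f → Constant (b ⋆ f)) total≡ₚ0
                 (λ {f} {f′} {m} f′-periodic f≡Δf′+m → ⋆-constant-antidifference b {f} {f′} {m} f′-periodic f≡Δf′+m)
                 (λ {f} {g} {c} _ → ⋆-constant-quotient b {f} {g} {c})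

  ⋆-constant⇒constant : ∀ {a e} → Periodic a → Periodic e → Constant (a ⋆ e) → ¬ Constant e → Constant a
  ⋆-constant⇒constant {a} {e} a-periodic e-periodic ae-const ¬e-const = descent a-periodic ae-const
    where
    total≡ₚ0 : ∀ {f} → Periodic f → Constant (f ⋆ e) → total f ≡ₚ 0ℤ
    total≡ₚ0 {f} f-periodic fe-const = decidable-stable (total f ≟ₚ 0ℤ) λ total-f≢0 →
      ¬e-const (unit-⋆-constant⇒constant {f} total-f≢0 {e} e-periodic fe-const)
    Φ-antidifference : ∀ {f f′ m} → Periodic f′ → (∀ y → f y ≡ Δ f′ y + m) → Constant (f ⋆ e) → Constant (f′ ⋆ e)
    Φ-antidifference {f} {f′} {m} f′-periodic f≡Δf′+m fe-const =
      ⋆-constant-comm e-periodic f′-periodic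
        (⋆-constant-antidifference e {f} {f′} {m} f′-periodic f≡Δf′+m
          (⋆-constant-comm (antidifference-periodic {f} {f′} {m} f′-periodic f≡Δf′+m) e-periodic fe-const))
    Φ-quotient : ∀ {f g c} → Periodic g → (∀ y → f y ≡ P * g y + c) → Constant (f ⋆ e) → Constant (g ⋆ e)
    Φ-quotient {f} {g} {c} g-periodic f≡Pg+c fe-const =
      ⋆-constant-comm e-periodic g-periodic
        (⋆-constant-quotient e {f} {g} {c} f≡Pg+c
          (⋆-constant-comm (scale-periodic {f} {g} {c} g-periodic f≡Pg+c) e-periodic fe-const))
    open Descent (λ f → Constant (f ⋆ e)) total≡ₚ0 Φ-antidifference Φ-quotient

module Box (q : ℕ) (p-prime : Prime (suc q)) where
  open PrimeModulus q p-prime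

  BoxPoint : ℕ → Set
  BoxPoint = Vec (Fin p)

  embed : ∀ {n} → BoxPoint n → Point n
  embed = Vec.map ⟪_⟫

  origin : ∀ {n} → BoxPoint n
  origin = Vec.replicate _ zero

  boxSum : ∀ {n} → (BoxPoint n → ℤ) → ℤ
  boxSum {zero}  g = g []
  boxSum {suc n} g = sum {p} (λ t → boxSum (λ y → g (t ∷ y)))

  boxSum-cong : ∀ {n} {g h : BoxPoint n → ℤ} → (∀ y → g y ≡ h y) → boxSum g ≡ boxSum h
  boxSum-cong {zero}  g≗h = g≗h []
  boxSum-cong {suc n} g≗h = sum-cong-≗ {p} λ t → boxSum-cong (λ y → g≗h (t ∷ y))

  boxSum-sum : ∀ {n m} (f : Fin m → BoxPoint n → ℤ) → boxSum (λ y → sum (λ i → f i y)) ≡ sum (λ i → boxSum (f i))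
  boxSum-sum {zero}  f = refl
  boxSum-sum {suc n} f = trans (sum-cong-≗ {p} λ t → boxSum-sum (λ i y → f i (t ∷ y)))
                               (∑-comm (λ t i → boxSum (λ y → f i (t ∷ y))))

  boxSum-*ʳ : ∀ {n} (g : BoxPoint n → ℤ) k → boxSum (λ y → g y * k) ≡ boxSum g * k
  boxSum-*ʳ {zero}  g k = refl
  boxSum-*ʳ {suc n} g k = trans (sum-cong-≗ {p} λ t → boxSum-*ʳ (λ y → g (t ∷ y)) k)
                                (sym (*-distribʳ-sum k (λ t → boxSum (λ y → g (t ∷ y)))))

  boxSum-const : ∀ n c → boxSum {n} (λ _ → c) ≡ + (p ℕ.^ n) * c
  boxSum-const zero    c = sym (ℤₚ.*-identityˡ c)
  boxSum-const (suc n) c = begin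
    sum {p} (λ _ → boxSum {n} (λ _ → c))   ≡⟨ sum-cong-≗ {p} (λ _ → boxSum-const n c) ⟩
    sum {p} (λ _ → + (p ℕ.^ n) * c)        ≡⟨ sum-const p (+ (p ℕ.^ n) * c) ⟩
    P * (+ (p ℕ.^ n) * c)                  ≡⟨ ℤₚ.*-assoc P (+ (p ℕ.^ n)) c ⟨
    P * + (p ℕ.^ n) * c                    ≡⟨ cong (_* c) (ℤₚ.pos-* p (p ℕ.^ n)) ⟨
    + (p ℕ.^ suc n) * c                    ∎
    where open ≡-Reasoning

  infix 4 _≡ᵥₚ_
  _≡ᵥₚ_ : ∀ {n} → Point n → Point n → Set
  _≡ᵥₚ_ = Pointwise _≡ₚ_

  ≡ᵥₚ-refl : ∀ {n} {x : Point n} → x ≡ᵥₚ x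
  ≡ᵥₚ-refl = Pointwise.refl ≡ₚ-refl

  ≡ᵥₚ-+ᵥ : ∀ {n} {x x′ y y′ : Point n} → x ≡ᵥₚ x′ → y ≡ᵥₚ y′ → x +ᵥ y ≡ᵥₚ x′ +ᵥ y′
  ≡ᵥₚ-+ᵥ []         []         = []
  ≡ᵥₚ-+ᵥ (a ∷ x≡x′) (b ∷ y≡y′) = ≡ₚ-+ a b ∷ ≡ᵥₚ-+ᵥ x≡x′ y≡y′

  ∙-congˡₚ : ∀ {n} (w : Point n) {x y} → x ≡ᵥₚ y → w ∙ x ≡ₚ w ∙ y
  ∙-congˡₚ []      []         = ≡ₚ-refl
  ∙-congˡₚ (c ∷ w) (a ∷ x≡y) = ≡ₚ-+ (≡ₚ-*ˡ c a) (∙-congˡₚ w x≡y)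

  embed-residue : ∀ {n} (x : Point n) → embed (Vec.map residue x) ≡ᵥₚ x
  embed-residue []      = []
  embed-residue (a ∷ x) = ⟪residue⟫ a ∷ embed-residue x

  ≡ᵥₚ⇒+P·ᵥ : ∀ {n} {x y : Point n} → x ≡ᵥₚ y → ∃ λ d → y ≡ x +ᵥ (P ·ᵥ d)
  ≡ᵥₚ⇒+P·ᵥ [] = [] , refl
  ≡ᵥₚ⇒+P·ᵥ {x = a ∷ x} {b ∷ y} (mk (divides k a-b≡kP) ∷ x≡y) with ≡ᵥₚ⇒+P·ᵥ x≡y
  ... | d , y≡x+Pd = (- k ∷ d) , cong₂ _∷_ (lemma a b k P a-b≡kP) y≡x+Pd
    where lemma : ∀ a b k P → a - b ≡ k * P → b ≡ a + P * - k
          lemma a b k P e = trans (lemma₁ a b) (trans (cong (_-_ a) e) (lemma₂ a k P))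
            where lemma₁ : ∀ a b → b ≡ a - (a - b)
                  lemma₁ = solve-∀
                  lemma₂ : ∀ a k P → a - k * P ≡ a + P * - k
                  lemma₂ = solve-∀

  PeriodicPoint : ∀ {n} → (Point n → ℤ) → Set
  PeriodicPoint {n} G = ∀ {x y : Point n} → x ≡ᵥₚ y → G x ≡ G y

  boxSum-translate : ∀ {n} (G : Point n → ℤ) → PeriodicPoint G → ∀ s → boxSum (λ y → G (embed y +ᵥ s)) ≡ boxSum (G ∘ embed)
  boxSum-translate {zero}  G G-periodic []      = refl
  boxSum-translate {suc n} G G-periodic (s₀ ∷ s) = begin
    sum (λ t → boxSum (λ y → G ((⟪ t ⟫ + s₀) ∷ (embed y +ᵥ s))))
      ≡⟨ sum-cong-≗ {p} (λ t → boxSum-translate (λ z → G ((⟪ t ⟫ + s₀) ∷ z)) (λ x≡y → G-periodic (≡ₚ-refl ∷ x≡y)) s) ⟩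
    sum (λ t → boxSum (λ y → G ((⟪ t ⟫ + s₀) ∷ embed y)))
      ≡⟨ boxSum-sum (λ t y → G ((⟪ t ⟫ + s₀) ∷ embed y)) ⟨
    boxSum (λ y → sum (λ t → G ((⟪ t ⟫ + s₀) ∷ embed y)))
      ≡⟨ boxSum-cong (λ y → sum-translate (λ a → G (a ∷ embed y)) (λ a≡b → G-periodic (a≡b ∷ ≡ᵥₚ-refl)) s₀) ⟩
    boxSum (λ y → sum (λ t → G (⟪ t ⟫ ∷ embed y)))
      ≡⟨ boxSum-sum (λ t y → G (⟪ t ⟫ ∷ embed y)) ⟩
    sum (λ t → boxSum (λ y → G (⟪ t ⟫ ∷ embed y)))
      ∎
    where open ≡-Reasoning

  δ-shift : ∀ a u c → δ (a + u) c ≡ δ u (c - a)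
  δ-shift a u c = δ-iff (λ e → ≡ₚ-trans (≡⇒≡ₚ (lemma₁ a u)) (≡ₚ-- e (≡ₚ-refl {a})))
                        (λ e → ≡ₚ-trans (≡ₚ-+ (≡ₚ-refl {a}) e) (≡⇒≡ₚ (lemma₂ a c)))
    where lemma₁ : ∀ a u → u ≡ a + u - a
          lemma₁ = solve-∀
          lemma₂ : ∀ a c → a + (c - a) ≡ c
          lemma₂ = solve-∀

  Nonzero : ∀ {n} → BoxPoint n → Set
  Nonzero = Any (_≢ zero)

  Nonzero? : ∀ {n} (w : BoxPoint n) → Dec (Nonzero w)
  Nonzero? = any? (λ t → ¬? (t Fin.≟ zero))

  neg-⟪⟫≢ₚ0 : ∀ {l : Fin p} → l ≢ zero → ¬ (- ⟪ l ⟫ ≡ₚ 0ℤ)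
  neg-⟪⟫≢ₚ0 {l} l≢0 e = ⟪⟫-distinct l≢0 (≡ₚ-trans (≡⇒≡ₚ (trans (ℤₚ.+-identityʳ ⟪ l ⟫) (sym (ℤₚ.neg-involutive ⟪ l ⟫)))) (≡ₚ-neg e))

  embed-origin-∙ : ∀ {n} (y : BoxPoint n) → embed (origin {n}) ∙ embed y ≡ 0ℤ
  embed-origin-∙ []      = refl
  embed-origin-∙ (t ∷ y) = trans (cong (_+_ (0ℤ * ⟪ t ⟫)) (embed-origin-∙ y)) (trans (ℤₚ.+-identityʳ _) (ℤₚ.*-zeroˡ ⟪ t ⟫))

  count : ∀ {n} → BoxPoint n → ℤ → ℤ
  count w d = boxSum (λ y → δ (embed w ∙ embed y) d)

  count-periodic : ∀ {n} (w : BoxPoint n) → Periodic (count w)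
  count-periodic w d≡d′ = boxSum-cong λ y → δ-cong (≡ₚ-refl {embed w ∙ embed y}) d≡d′

  count-line : ∀ {n} l (g : BoxPoint n) d → count (l ∷ g) d ≡ sum {p} (λ t → count g (- ⟪ l ⟫ * ⟪ t ⟫ + d))
  count-line l g d = sum-cong-≗ {p} λ t → boxSum-cong λ y →
    trans (δ-shift (⟪ l ⟫ * ⟪ t ⟫) (embed g ∙ embed y) d) (cong (δ (embed g ∙ embed y)) (lemma d ⟪ l ⟫ ⟪ t ⟫))
    where lemma : ∀ d l t → d - l * t ≡ - l * t + d
          lemma = solve-∀

  count-constant : ∀ {n} {w : BoxPoint n} → Nonzero w → Constant (count w)
  count-constant {w = l ∷ g} (here l≢0) d = begin
    count (l ∷ g) ⟪ d ⟫                              ≡⟨ count-line l g ⟪ d ⟫ ⟩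
    sum (λ t → count g (- ⟪ l ⟫ * ⟪ t ⟫ + ⟪ d ⟫))   ≡⟨ sum-affine (count g) (count-periodic g) (- ⟪ l ⟫) ⟪ d ⟫ (neg-⟪⟫≢ₚ0 l≢0) ⟩
    total (count g)                                  ≡⟨ sum-affine (count g) (count-periodic g) (- ⟪ l ⟫) 0ℤ (neg-⟪⟫≢ₚ0 l≢0) ⟨
    sum (λ t → count g (- ⟪ l ⟫ * ⟪ t ⟫ + 0ℤ))      ≡⟨ count-line l g 0ℤ ⟨
    count (l ∷ g) 0ℤ                                 ∎
    where open ≡-Reasoning
  count-constant {w = l ∷ g} (there g≢0) d =
    trans (count-line l g ⟪ d ⟫) (trans (sum-cong-≗ {p} λ t → trans (flat (- ⟪ l ⟫ * ⟪ t ⟫ + ⟪ d ⟫)) (sym (flat (- ⟪ l ⟫ * ⟪ t ⟫ + 0ℤ))))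
                                        (sym (count-line l g 0ℤ)))
    where flat : ∀ y → count g y ≡ count g 0ℤ
          flat = periodic-constant (count-periodic g) (count-constant g≢0)

  projection : ∀ {n} → (BoxPoint n → ℤ) → BoxPoint n → ℤ → ℤ
  projection s w c = boxSum (λ y → s y * δ (embed w ∙ embed y) c)

  projection-periodic : ∀ {n} (s : BoxPoint n → ℤ) w → Periodic (projection s w)
  projection-periodic s w c≡c′ = boxSum-cong λ y → cong (s y *_) (δ-cong (≡ₚ-refl {embed w ∙ embed y}) c≡c′)

  projection-line : ∀ {n} (s : BoxPoint (suc n) → ℤ) l (g : BoxPoint n) c →
                    projection s (l ∷ g) c ≡ sum {p} (λ t → projection (λ y → s (t ∷ y)) g (c - ⟪ l ⟫ * ⟪ t ⟫))
  projection-line s l g c = sum-cong-≗ {p} λ t → boxSum-cong λ y →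
    cong (s (t ∷ y) *_) (δ-shift (⟪ l ⟫ * ⟪ t ⟫) (embed g ∙ embed y) c)

  Balanced : ∀ {n} → (BoxPoint n → ℤ) → Set
  Balanced {n} s = ∀ (w : BoxPoint n) → Nonzero w → Constant (projection s w)

  -- Summing the lines through (t₀, c₀) of all slopes l counts the column t₀ p times and every other column once.
  lines-constant⇒constant : (M : Fin p → ℤ → ℤ) → (∀ t → Periodic (M t)) →
                            (∀ l → Constant (λ c → sum {p} (λ t → M t (c - ⟪ l ⟫ * ⟪ t ⟫)))) →
                            ∀ t → Constant (M t)
  lines-constant⇒constant M M-periodic lines-const t₀ c = P*-cancel (trans (key ⟪ c ⟫) (sym (key 0ℤ)))
    where
    line : Fin p → ℤ → ℤ
    line l c = sum {p} (λ t → M t (c - ⟪ l ⟫ * ⟪ t ⟫))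
    line-periodic : ∀ l → Periodic (line l)
    line-periodic l c≡c′ = sum-cong-≗ {p} λ t → M-periodic t (≡ₚ-- c≡c′ (≡ₚ-refl {⟪ l ⟫ * ⟪ t ⟫}))
    R : Fin p → ℤ
    R t = total (M t)
    Λ : ℤ
    Λ = sum {p} (λ l → line l 0ℤ)
    F : ℤ → Fin p → ℤ
    F c₀ t = sum {p} (λ l → M t ((⟪ t₀ ⟫ - ⟪ t ⟫) * ⟪ l ⟫ + c₀))
    lemma : ∀ c₀ l t₀ t → c₀ + l * t₀ - l * t ≡ (t₀ - t) * l + c₀
    lemma = solve-∀
    Λ≡∑F : ∀ c₀ → Λ ≡ sum (F c₀)
    Λ≡∑F c₀ = begin
      Λ                                                          ≡⟨ sum-cong-≗ {p} (λ l → periodic-constant (line-periodic l) (lines-const l) (c₀ + ⟪ l ⟫ * ⟪ t₀ ⟫)) ⟨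
      sum (λ l → line l (c₀ + ⟪ l ⟫ * ⟪ t₀ ⟫))                   ≡⟨ sum-cong-≗ {p} (λ l → sum-cong-≗ {p} λ t → cong (M t) (lemma c₀ ⟪ l ⟫ ⟪ t₀ ⟫ ⟪ t ⟫)) ⟩
      sum (λ l → sum (λ t → M t ((⟪ t₀ ⟫ - ⟪ t ⟫) * ⟪ l ⟫ + c₀)))  ≡⟨ ∑-comm (λ l t → M t ((⟪ t₀ ⟫ - ⟪ t ⟫) * ⟪ l ⟫ + c₀)) ⟩
      sum (F c₀)                                                 ∎
      where open ≡-Reasoning
    F-t₀ : ∀ c₀ → F c₀ t₀ ≡ P * M t₀ c₀
    F-t₀ c₀ = trans (sum-cong-≗ {p} λ l → cong (M t₀) (trans (cong (λ z → z * ⟪ l ⟫ + c₀) (ℤₚ.+-inverseʳ ⟪ t₀ ⟫)) (ℤₚ.+-identityˡ c₀)))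
                    (sum-const p (M t₀ c₀))
    F-t : ∀ c₀ t → t ≢ t₀ → F c₀ t ≡ R t
    F-t c₀ t t≢t₀ = sum-affine (M t) (M-periodic t) (⟪ t₀ ⟫ - ⟪ t ⟫) c₀ (⟪⟫-distinct (t≢t₀ ∘ sym))
    key : ∀ c₀ → P * M t₀ c₀ ≡ Λ - sum R + R t₀
    key c₀ = sym (begin
      Λ - sum R + R t₀                              ≡⟨ cong (λ z → z - sum R + R t₀) (trans (Λ≡∑F c₀) (sum-differ-at (F c₀) R t₀ (F-t c₀))) ⟩
      sum R + (F c₀ t₀ - R t₀) - sum R + R t₀       ≡⟨ cong (λ z → sum R + (z - R t₀) - sum R + R t₀) (F-t₀ c₀) ⟩
      sum R + (P * M t₀ c₀ - R t₀) - sum R + R t₀   ≡⟨ lemma′ (sum R) (P * M t₀ c₀) (R t₀) ⟩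
      P * M t₀ c₀                                   ∎)
      where open ≡-Reasoning
            lemma′ : ∀ a b c → a + (b - c) - a + c ≡ b
            lemma′ = solve-∀

  one : Fin p
  one = Fin.fromℕ< 1<p

  ⟪one⟫ : ⟪ one ⟫ ≡ 1ℤ
  ⟪one⟫ = cong +_ (Finₚ.toℕ-fromℕ< 1<p)

  one≢zero : one ≢ zero
  one≢zero one≡zero with trans (sym (Finₚ.toℕ-fromℕ< 1<p)) (cong toℕ one≡zero)
  ... | ()

  projection-vertical : ∀ {n} (s : BoxPoint (suc n) → ℤ) t → projection s (one ∷ origin) ⟪ t ⟫ ≡ boxSum (λ y → s (t ∷ y))
  projection-vertical {n} s t = begin
    sum (λ t′ → boxSum (λ y → s (t′ ∷ y) * δ (⟪ one ⟫ * ⟪ t′ ⟫ + embed origin ∙ embed y) ⟪ t ⟫))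
      ≡⟨ sum-cong-≗ {p} (λ t′ → boxSum-cong λ y → cong (λ z → s (t′ ∷ y) * δ z ⟪ t ⟫) (pick t′ y)) ⟩
    sum (λ t′ → boxSum (λ y → s (t′ ∷ y) * δ ⟪ t′ ⟫ ⟪ t ⟫))
      ≡⟨ sum-cong-≗ {p} (λ t′ → trans (boxSum-*ʳ (λ y → s (t′ ∷ y)) (δ ⟪ t′ ⟫ ⟪ t ⟫))
                                      (trans (ℤₚ.*-comm (boxSum (λ y → s (t′ ∷ y))) (δ ⟪ t′ ⟫ ⟪ t ⟫))
                                             (cong (δ ⟪ t′ ⟫ ⟪ t ⟫ *_) (column-residue t′)))) ⟩
    sum (λ t′ → δ ⟪ t′ ⟫ ⟪ t ⟫ * column ⟪ t′ ⟫)
      ≡⟨ sum-δ column column-periodic ⟪ t ⟫ ⟩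
    column ⟪ t ⟫
      ≡⟨ column-residue t ⟨
    boxSum (λ y → s (t ∷ y))
      ∎
    where
    open ≡-Reasoning
    column : ℤ → ℤ
    column a = boxSum (λ y → s (residue a ∷ y))
    column-periodic : Periodic column
    column-periodic a≡b = cong (λ r → boxSum (λ y → s (r ∷ y))) (residue-cong a≡b)
    column-residue : ∀ t′ → boxSum (λ y → s (t′ ∷ y)) ≡ column ⟪ t′ ⟫
    column-residue t′ = cong (λ r → boxSum (λ y → s (r ∷ y))) (sym (residue-⟪⟫ t′))
    pick : ∀ t′ (y : BoxPoint n) → ⟪ one ⟫ * ⟪ t′ ⟫ + embed origin ∙ embed y ≡ ⟪ t′ ⟫
    pick t′ y = trans (cong₂ _+_ (trans (cong (_* ⟪ t′ ⟫) ⟪one⟫) (ℤₚ.*-identityˡ ⟪ t′ ⟫)) (embed-origin-∙ y)) (ℤₚ.+-identityʳ ⟪ t′ ⟫)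

  balanced⇒constant : ∀ {n} (s : BoxPoint n → ℤ) → Balanced s → ∀ y → s y ≡ s origin
  balanced⇒constant {zero}  s _        [] = refl
  balanced⇒constant {suc n} s balanced (t ∷ y) =
    trans (balanced⇒constant (column t) (column-balanced t) y) (vertical t)
    where
    column : Fin p → BoxPoint n → ℤ
    column t y = s (t ∷ y)
    column-balanced : ∀ t → Balanced (column t)
    column-balanced t g g≢0 =
      lines-constant⇒constant (λ t′ → projection (column t′) g) (λ t′ → projection-periodic (column t′) g)
        (λ l c → trans (sym (projection-line s l g ⟪ c ⟫)) (trans (balanced (l ∷ g) (there g≢0) c) (projection-line s l g 0ℤ)))
        t
    flat : ∀ t → boxSum (column t) ≡ + (p ℕ.^ n) * s (t ∷ origin)
    flat t = trans (boxSum-cong (balanced⇒constant (column t) (column-balanced t))) (boxSum-const n (s (t ∷ origin)))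
    vertical : ∀ t → s (t ∷ origin) ≡ s (zero ∷ origin)
    vertical t = ℤₚ.*-cancelˡ-≡ (+ (p ℕ.^ n)) (s (t ∷ origin)) (s (zero ∷ origin)) ⦃ ℕₚ.m^n≢0 p n ⦄ (begin
      + (p ℕ.^ n) * s (t ∷ origin)         ≡⟨ flat t ⟨
      boxSum (column t)                    ≡⟨ projection-vertical s t ⟨
      projection s (one ∷ origin) ⟪ t ⟫    ≡⟨ balanced (one ∷ origin) (here one≢zero) t ⟩
      projection s (one ∷ origin) 0ℤ       ≡⟨ projection-vertical s zero ⟩
      boxSum (column zero)                 ≡⟨ flat zero ⟩
      + (p ℕ.^ n) * s (zero ∷ origin)      ∎)
      where open ≡-Reasoning

  all?-box : ∀ {n} {Q : BoxPoint n → Set} → (∀ w → Dec (Q w)) → Dec (∀ w → Q w)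
  all?-box {zero}  Q? with Q? []
  ... | yes q[] = yes λ { [] → q[] }
  ... | no ¬q[] = no λ ∀Q → ¬q[] (∀Q [])
  all?-box {suc n} Q? with Finₚ.all? (λ t → all?-box (λ w → Q? (t ∷ w)))
  ... | yes ∀Q = yes λ { (t ∷ w) → ∀Q t w }
  ... | no ¬∀Q = no λ ∀Q → ¬∀Q (λ t w → ∀Q (t ∷ w))

  ¬∀⇒∃¬-box : ∀ {n} {Q : BoxPoint n → Set} → (∀ w → Dec (Q w)) → ¬ (∀ w → Q w) → ∃ λ w → ¬ Q w
  ¬∀⇒∃¬-box {zero}  Q? ¬∀Q = [] , λ q[] → ¬∀Q λ { [] → q[] }
  ¬∀⇒∃¬-box {suc n} {Q} Q? ¬∀Q with Finₚ.¬∀⟶∃¬ p _ (λ t → all?-box (λ w → Q? (t ∷ w))) (λ ∀Q → ¬∀Q λ { (t ∷ w) → ∀Q t w })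
  ... | t , ¬∀Qt with ¬∀⇒∃¬-box (λ w → Q? (t ∷ w)) ¬∀Qt
  ...   | w , ¬Qtw = t ∷ w , ¬Qtw

  unbalanced-direction : ∀ {n} (s : BoxPoint n → ℤ) → ¬ Balanced s → ∃ λ w → Nonzero w × ¬ Constant (projection s w)
  unbalanced-direction s ¬balanced with ¬∀⇒∃¬-box (λ w → Nonzero? w →-dec Constant? (projection s w)) ¬balanced
  ... | w , ¬[nonzero⇒constant] =
    w , decidable-stable (Nonzero? w) (λ ¬nonzero → ¬[nonzero⇒constant] (⊥-elim ∘ ¬nonzero))
      , λ constant → ¬[nonzero⇒constant] (λ _ → constant)

module TilingIndicator {n q : ℕ} (v : Fin (suc q) → Point n) (v₀≡0 : v zero ≡ 0ᵥ)
                       (L : Pred (Point n) 0ℓ) (tiling : IsTiling v L) where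

  tile : Point n → Fin (suc q)
  tile x = proj₁ (proj₁ (tiling x))

  offset : Point n → Point n
  offset x = proj₁ (proj₂ (proj₁ (tiling x)))

  offset∈L : ∀ x → L (offset x)
  offset∈L x = proj₁ (proj₂ (proj₂ (proj₁ (tiling x))))

  tile-decomposition : ∀ x → v (tile x) +ᵥ offset x ≡ x
  tile-decomposition x = proj₂ (proj₂ (proj₂ (proj₁ (tiling x))))

  unique-tile : ∀ x {i j l l′} → L l → L l′ → v i +ᵥ l ≡ x → v j +ᵥ l′ ≡ x → i ≡ j
  unique-tile x {i} {j} {l} {l′} l∈L l′∈L eq eq′ = proj₁ (proj₂ (tiling x) i j l l′ l∈L l′∈L eq eq′)

  v₀+ᵥ : ∀ x → v zero +ᵥ x ≡ x
  v₀+ᵥ x = trans (cong (_+ᵥ x) v₀≡0) (+ᵥ-identityˡ x)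

  ∈L⇒tile≡0 : ∀ {y} → L y → tile y ≡ zero
  ∈L⇒tile≡0 {y} y∈L = sym (unique-tile y y∈L (offset∈L y) (v₀+ᵥ y) (tile-decomposition y))

  tile≡0⇒∈L : ∀ {y} → tile y ≡ zero → L y
  tile≡0⇒∈L {y} tile≡0 = subst L (trans (sym (v₀+ᵥ (offset y))) (trans (cong (λ i → v i +ᵥ offset y) (sym tile≡0)) (tile-decomposition y)))
                                (offset∈L y)

  𝟙L : Point n → ℕ
  𝟙L y with tile y Fin.≟ zero
  ... | yes _ = 1
  ... | no  _ = 0

  𝟙L≤1 : ∀ y → 𝟙L y ℕ.≤ 1
  𝟙L≤1 y with tile y Fin.≟ zero
  ... | yes _ = s≤s z≤n
  ... | no  _ = z≤n

  𝟙L-∈ : ∀ {y} → L y → 𝟙L y ≡ 1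
  𝟙L-∈ {y} y∈L with tile y Fin.≟ zero
  ... | yes _       = refl
  ... | no tile≢0  = ⊥-elim (tile≢0 (∈L⇒tile≡0 y∈L))

  𝟙L-∉ : ∀ {y} → ¬ L y → 𝟙L y ≡ 0
  𝟙L-∉ {y} y∉L with tile y Fin.≟ zero
  ... | yes tile≡0 = ⊥-elim (y∉L (tile≡0⇒∈L tile≡0))
  ... | no _       = refl

  tiling-sum : ∀ x → sum (λ i → + 𝟙L (x -ᵥ v i)) ≡ 1ℤ
  tiling-sum x = trans (sum-single (tile x) _ off-tile) (cong +_ (𝟙L-∈ x-v∈L))
    where
    x-v∈L : L (x -ᵥ v (tile x))
    x-v∈L = subst L (sym (trans (cong (_-ᵥ v (tile x)) (trans (sym (tile-decomposition x)) (+ᵥ-comm (v (tile x)) (offset x))))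
                           (+ᵥ-ᵥ-cancel (offset x) (v (tile x))))) (offset∈L x)
    off-tile : ∀ i → i ≢ tile x → + 𝟙L (x -ᵥ v i) ≡ 0ℤ
    off-tile i i≢tile = cong +_ (𝟙L-∉ λ x-vᵢ∈L →
      i≢tile (unique-tile x x-vᵢ∈L (offset∈L x) (trans (+ᵥ-comm (v i) (x -ᵥ v i)) (-ᵥ+ᵥ-cancel x (v i))) (tile-decomposition x)))

module PeriodicTiling {n q : ℕ} (p-prime : Prime (suc q))
                      (v : Fin (suc q) → Point n) (v₀≡0 : v zero ≡ 0ᵥ)
                      (generates : Generates (λ (i : Fin q) → v (suc i)))
                      (L : Pred (Point n) 0ℓ) (tiling : IsTiling v L) where
  open PrimeModulus q p-prime
  open Operators (Point n)
  open Frobenius q p-prime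
  open TilingIndicator v v₀≡0 L tiling
  open Box q p-prime using (_≡ᵥₚ_; ≡ᵥₚ⇒+P·ᵥ)

  private
    shifts : Fin p → Point n → Point n
    shifts i y = y -ᵥ v i

    shifts-commute : ∀ i j y → shifts i (shifts j y) ≡ shifts j (shifts i y)
    shifts-commute i j y = trans (-ᵥ-+ᵥ y (v j) (v i)) (trans (cong (_-ᵥ_ y) (+ᵥ-comm (v j) (v i))) (sym (-ᵥ-+ᵥ y (v i) (v j))))

    iterate-shifts : ∀ i k y → iterate (shifts i) k y ≡ y -ᵥ ((+ k) ·ᵥ v i)
    iterate-shifts i zero    y = sym (trans (cong (_-ᵥ_ y) (·ᵥ-zeroˡ (v i))) (-ᵥ-zero y))
    iterate-shifts i (suc k) y = trans (iterate-shifts i k (y -ᵥ v i))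
                                       (trans (-ᵥ-+ᵥ y (v i) ((+ k) ·ᵥ v i)) (cong (_-ᵥ_ y) (sym (·ᵥ-suc k (v i)))))

    𝟙Lℤ : Point n → ℤ
    𝟙Lℤ y = + 𝟙L y

    p∣p^q : p ℕ∣.∣ p ℕ.^ q
    p∣p^q = divides-power q 1<p
      where divides-power : ∀ k → 1 ℕ.< suc k → p ℕ∣.∣ p ℕ.^ k
            divides-power zero    (s≤s ())
            divides-power (suc k) _ = ℕ∣.divides (p ℕ.^ k) (ℕₚ.*-comm p (p ℕ.^ k))

  p∣∑𝟙L[x-Pv] : ∀ x → p ℕ∣.∣ ℕΣ.sum (λ i → 𝟙L (x -ᵥ (P ·ᵥ v i)))
  p∣∑𝟙L[x-Pv] x = ∣⇒∣ᵤ (≡ₚ0⇒∣ (begin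
    + ℕΣ.sum (λ i → 𝟙L (x -ᵥ (P ·ᵥ v i)))         ≡⟨ sum-pos (λ i → 𝟙L (x -ᵥ (P ·ᵥ v i))) ⟨
    sum (λ i → 𝟙Lℤ (x -ᵥ (P ·ᵥ v i)))             ≡⟨ sum-cong-≗ {p} (λ i → cong 𝟙Lℤ (iterate-shifts i p x)) ⟨
    sum (λ i → 𝟙Lℤ (iterate (shifts i) p x))      ≈⟨ frobenius shifts shifts-commute 𝟙Lℤ x ⟨
    apply (shiftSum shifts ^ᵒ p) 𝟙Lℤ x            ≡⟨ ^ᵒ-suc (shiftSum shifts) q 𝟙Lℤ x ⟩
    apply (shiftSum shifts ^ᵒ q) (apply (shiftSum shifts) 𝟙Lℤ) x
                                                  ≡⟨ apply-cong (shiftSum shifts ^ᵒ q) tiling-sum x ⟩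
    apply (shiftSum shifts ^ᵒ q) (λ _ → 1ℤ) x     ≡⟨ shiftSum-const shifts q 1ℤ x ⟩
    + (p ℕ.^ q) * 1ℤ                              ≈⟨ multiple≡ₚ0 (p ℕ.^ q) 1ℤ p∣p^q ⟩
    0ℤ                                            ∎))
    where open ≡ₚ-Reasoning

  𝟙L-translate : ∀ x i → 𝟙L (x -ᵥ (P ·ᵥ v i)) ≡ 𝟙L x
  𝟙L-translate x i = trans (all-or-none (λ j → 𝟙L (x -ᵥ (P ·ᵥ v j))) (λ j → 𝟙L≤1 _) (p∣∑𝟙L[x-Pv] x) i zero)
                           (cong 𝟙L (trans (cong (λ z → x -ᵥ (P ·ᵥ z)) v₀≡0) (trans (cong (_-ᵥ_ x) (·ᵥ-zeroʳ P)) (-ᵥ-zero x))))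

  Invariant : Point n → Set
  Invariant s = ∀ x → 𝟙L (x +ᵥ s) ≡ 𝟙L x

  invariant-+ᵥ : ∀ {s s′} → Invariant s → Invariant s′ → Invariant (s +ᵥ s′)
  invariant-+ᵥ {s} {s′} inv inv′ x = trans (cong 𝟙L (sym (+ᵥ-assoc x s s′))) (trans (inv′ (x +ᵥ s)) (inv x))

  invariant-neg : ∀ {s} → Invariant s → Invariant (-ᵥ s)
  invariant-neg {s} inv x = trans (sym (inv (x -ᵥ s))) (cong 𝟙L (-ᵥ+ᵥ-cancel x s))

  P·ᵥ-invariant-subgroup : IsSubgroup (λ d → Invariant (P ·ᵥ d))
  P·ᵥ-invariant-subgroup =
      (λ x → cong 𝟙L (trans (cong (x +ᵥ_) (·ᵥ-zeroʳ P)) (+ᵥ-identityʳ x)))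
    , (λ d d′ inv inv′ → subst Invariant (sym (·ᵥ-distribˡ P d d′)) (invariant-+ᵥ inv inv′))
    , (λ d inv → subst Invariant (sym (·ᵥ-negʳ P d)) (invariant-neg inv))

  invariant-P·ᵥ : ∀ d → Invariant (P ·ᵥ d)
  invariant-P·ᵥ = generators⊆⇒total P·ᵥ-invariant-subgroup generates λ i x →
    trans (sym (𝟙L-translate (x +ᵥ (P ·ᵥ v (suc i))) (suc i))) (cong 𝟙L (+ᵥ-ᵥ-cancel x (P ·ᵥ v (suc i))))

  𝟙L-periodic : ∀ {x y} → x ≡ᵥₚ y → 𝟙L x ≡ 𝟙L y
  𝟙L-periodic {x} x≡y with ≡ᵥₚ⇒+P·ᵥ x≡y
  ... | d , y≡x+Pd = sym (trans (cong 𝟙L y≡x+Pd) (invariant-P·ᵥ d x))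

module LatticeTiling {n q : ℕ} (p-prime : Prime (suc q))
                     (v : Fin (suc q) → Point n) (v₀≡0 : v zero ≡ 0ᵥ)
                     (generates : Generates (λ (i : Fin q) → v (suc i)))
                     (L : Pred (Point n) 0ℓ) (tiling : IsTiling v L) where
  open PrimeModulus q p-prime
  open Box q p-prime
  open Convolution q p-prime
  open TilingIndicator v v₀≡0 L tiling
  open PeriodicTiling p-prime v v₀≡0 generates L tiling

  𝟙L-box : BoxPoint n → ℤ
  𝟙L-box y = + 𝟙L (embed y)

  𝟙L-box-unbalanced : ¬ Balanced 𝟙L-box
  𝟙L-box-unbalanced balanced = 1≢0 (begin
    1                                 ≡⟨ 𝟙L-∈ (offset∈L 0ᵥ) ⟨
    𝟙L x₁                             ≡⟨ 𝟙L-periodic (embed-residue x₁) ⟨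
    𝟙L (embed (Vec.map residue x₁))   ≡⟨ ℤₚ.+-injective (balanced⇒constant 𝟙L-box balanced (Vec.map residue x₁)) ⟩
    𝟙L (embed origin)                 ≡⟨ ℤₚ.+-injective (balanced⇒constant 𝟙L-box balanced (Vec.map residue x₂)) ⟨
    𝟙L (embed (Vec.map residue x₂))   ≡⟨ 𝟙L-periodic (embed-residue x₂) ⟩
    𝟙L x₂                             ≡⟨ 𝟙L-∉ x₂∉L ⟩
    0                                 ∎)
    where
    open ≡-Reasoning
    1≢0 : 1 ≢ 0
    1≢0 ()
    i₀ : Fin q
    i₀ = Fin.fromℕ< (ℕₚ.≤-pred 1<p)
    x₁ x₂ : Point n
    x₁ = offset 0ᵥ
    x₂ = x₁ +ᵥ v (suc i₀)
    x₂∉L : ¬ L x₂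
    x₂∉L x₂∈L with unique-tile x₂ x₂∈L (offset∈L 0ᵥ) (v₀+ᵥ x₂) (+ᵥ-comm (v (suc i₀)) x₁)
    ... | ()

  module Direction (w : BoxPoint n) (w≢0 : Nonzero w) (b-unbalanced : ¬ Constant (projection 𝟙L-box w)) where

    W : Point n
    W = embed w

    a : ℤ → ℤ
    a x = sum (λ i → δ x (W ∙ v i))

    b : ℤ → ℤ
    b = projection 𝟙L-box w

    a-periodic : Periodic a
    a-periodic x≡y = sum-cong-≗ {p} λ i → δ-cong x≡y (≡ₚ-refl {W ∙ v i})

    b-periodic : Periodic b
    b-periodic = projection-periodic 𝟙L-box w

    b-shift : ∀ x i → b (x - W ∙ v i) ≡ boxSum (λ y → + 𝟙L (embed y -ᵥ v i) * δ (W ∙ embed y) x)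
    b-shift x i = trans (boxSum-cong term) (boxSum-translate G G-periodic (v i))
      where
      G : Point n → ℤ
      G z = + 𝟙L (z -ᵥ v i) * δ (W ∙ z) x
      G-periodic : PeriodicPoint G
      G-periodic z≡z′ = cong₂ _*_ (cong +_ (𝟙L-periodic (≡ᵥₚ-+ᵥ z≡z′ ≡ᵥₚ-refl))) (δ-cong (∙-congˡₚ W z≡z′) ≡ₚ-refl)
      term : ∀ y → + 𝟙L (embed y) * δ (W ∙ embed y) (x - W ∙ v i) ≡ G (embed y +ᵥ v i)
      term y = cong₂ _*_ (cong (+_ ∘ 𝟙L) (sym (+ᵥ-ᵥ-cancel (embed y) (v i))))
                         (trans (sym (δ-shift (W ∙ v i) (W ∙ embed y) x))
                                (cong (λ z → δ z x) (trans (ℤₚ.+-comm (W ∙ v i) (W ∙ embed y)) (sym (∙-distribˡ-+ᵥ W (embed y) (v i))))))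

    -- Counting box points y by the residue of w·y, once directly and once through the tile containing y.
    a⋆b≡count : ∀ x → (a ⋆ b) x ≡ count w x
    a⋆b≡count x = begin
      sum (λ c → a ⟪ c ⟫ * b (x - ⟪ c ⟫))
        ≡⟨ sum-cong-≗ {p} (λ c → *-distribʳ-sum (b (x - ⟪ c ⟫)) (λ i → δ ⟪ c ⟫ (W ∙ v i))) ⟩
      sum (λ c → sum (λ i → δ ⟪ c ⟫ (W ∙ v i) * b (x - ⟪ c ⟫)))
        ≡⟨ ∑-comm (λ c i → δ ⟪ c ⟫ (W ∙ v i) * b (x - ⟪ c ⟫)) ⟩
      sum (λ i → sum (λ c → δ ⟪ c ⟫ (W ∙ v i) * b (x - ⟪ c ⟫)))
        ≡⟨ sum-cong-≗ {p} (λ i → sum-δ (λ c → b (x - c)) (λ c≡c′ → b-periodic (≡ₚ-- (≡ₚ-refl {x}) c≡c′)) (W ∙ v i)) ⟩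
      sum (λ i → b (x - W ∙ v i))
        ≡⟨ sum-cong-≗ {p} (b-shift x) ⟩
      sum (λ i → boxSum (λ y → + 𝟙L (embed y -ᵥ v i) * δ (W ∙ embed y) x))
        ≡⟨ boxSum-sum (λ i y → + 𝟙L (embed y -ᵥ v i) * δ (W ∙ embed y) x) ⟨
      boxSum (λ y → sum (λ i → + 𝟙L (embed y -ᵥ v i) * δ (W ∙ embed y) x))
        ≡⟨ boxSum-cong (λ y → trans (sym (*-distribʳ-sum (δ (W ∙ embed y) x) (λ i → + 𝟙L (embed y -ᵥ v i))))
                                    (trans (cong (_* δ (W ∙ embed y) x) (tiling-sum (embed y))) (ℤₚ.*-identityˡ _))) ⟩
      count w x
        ∎
      where open ≡-Reasoning

    a-constant : Constant a
    a-constant = ⋆-constant⇒constant a-periodic b-periodic a⋆b-constant b-unbalanced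
      where a⋆b-constant : Constant (a ⋆ b)
            a⋆b-constant c = trans (a⋆b≡count ⟪ c ⟫) (trans (count-constant w≢0 c) (sym (a⋆b≡count 0ℤ)))

    a≡1 : ∀ x → a x ≡ 1ℤ
    a≡1 x = trans (periodic-constant a-periodic a-constant x) (P*-cancel {a 0ℤ} {1ℤ} (begin
      P * a 0ℤ                                  ≡⟨ sum-const p (a 0ℤ) ⟨
      sum {p} (λ _ → a 0ℤ)                      ≡⟨ sum-cong-≗ {p} a-constant ⟨
      sum (λ c → sum (λ i → δ ⟪ c ⟫ (W ∙ v i)))  ≡⟨ ∑-comm (λ c i → δ ⟪ c ⟫ (W ∙ v i)) ⟩
      sum (λ i → sum (λ c → δ ⟪ c ⟫ (W ∙ v i)))  ≡⟨ sum-cong-≗ {p} (λ i → sum-δ₁ (W ∙ v i)) ⟩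
      sum {p} (λ _ → 1ℤ)                        ≡⟨ sum-const p 1ℤ ⟩
      P * 1ℤ                                    ∎))
      where open ≡-Reasoning

    L′ : Pred (Point n) 0ℓ
    L′ x = W ∙ x ≡ₚ 0ℤ

    L′-subgroup : IsSubgroup L′
    L′-subgroup = ≡⇒≡ₚ (∙-zeroʳ W)
                , (λ x y x∈L′ y∈L′ → ≡ₚ-trans (≡⇒≡ₚ (∙-distribˡ-+ᵥ W x y)) (≡ₚ-+ x∈L′ y∈L′))
                , (λ x x∈L′ → ≡ₚ-trans (≡⇒≡ₚ (∙-negʳ W x)) (≡ₚ-neg x∈L′))

    W∙-tile : ∀ {x i l} → L′ l → v i +ᵥ l ≡ x → W ∙ x ≡ₚ W ∙ v i
    W∙-tile {x} {i} {l} l∈L′ vᵢ+l≡x = begin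
      W ∙ x                 ≡⟨ cong (W ∙_) vᵢ+l≡x ⟨
      W ∙ (v i +ᵥ l)        ≡⟨ ∙-distribˡ-+ᵥ W (v i) l ⟩
      W ∙ v i + W ∙ l       ≈⟨ ≡ₚ-+ (≡ₚ-refl {W ∙ v i}) l∈L′ ⟩
      W ∙ v i + 0ℤ          ≡⟨ ℤₚ.+-identityʳ (W ∙ v i) ⟩
      W ∙ v i               ∎
      where open ≡ₚ-Reasoning

    L′-tiling : IsTiling v L′
    L′-tiling x = (i , x -ᵥ v i , x-vᵢ∈L′ , trans (+ᵥ-comm (v i) (x -ᵥ v i)) (-ᵥ+ᵥ-cancel x (v i))) , unique
      where
      residue-class = δ-sum≡1⇒∃ (W ∙ x) (λ i → W ∙ v i) (a≡1 (W ∙ x))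
      i : Fin p
      i = proj₁ residue-class
      W∙x≡W∙vᵢ : W ∙ x ≡ₚ W ∙ v i
      W∙x≡W∙vᵢ = proj₂ residue-class
      x-vᵢ∈L′ : L′ (x -ᵥ v i)
      x-vᵢ∈L′ = ≡ₚ-trans (≡⇒≡ₚ (trans (∙-distribˡ-+ᵥ W x (-ᵥ v i)) (cong (_+_ (W ∙ x)) (∙-negʳ W (v i)))))
                         (≡ₚ-trans (≡ₚ-- W∙x≡W∙vᵢ (≡ₚ-refl {W ∙ v i})) (≡⇒≡ₚ (ℤₚ.+-inverseʳ (W ∙ v i))))
      unique : ∀ j k l l′ → L′ l → L′ l′ → v j +ᵥ l ≡ x → v k +ᵥ l′ ≡ x → j ≡ k × l ≡ l′
      unique j k l l′ l∈L′ l′∈L′ vⱼ+l≡x vₖ+l′≡x =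
        j≡k , +ᵥ-cancelˡ (v j) l l′ (trans vⱼ+l≡x (sym (subst (λ m → v m +ᵥ l′ ≡ x) (sym j≡k) vₖ+l′≡x)))
        where j≡k = δ-sum≡1⇒unique (W ∙ x) (λ i → W ∙ v i) (a≡1 (W ∙ x)) (W∙-tile l∈L′ vⱼ+l≡x) (W∙-tile l′∈L′ vₖ+l′≡x)

    lattice-tiling : HasLatticeTiling v
    lattice-tiling = L′ , L′-subgroup , L′-tiling

  lattice-tiling : HasLatticeTiling v
  lattice-tiling = from-direction (unbalanced-direction 𝟙L-box 𝟙L-box-unbalanced)
    where from-direction : (∃ λ w → Nonzero w × ¬ Constant (projection 𝟙L-box w)) → HasLatticeTiling v
          from-direction (w , w≢0 , b-unbalanced) = Direction.lattice-tiling w w≢0 b-unbalanced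

theorem19 : ∀ (n q : ℕ) → Prime (suc q) → (v : Fin (suc q) → Point n) →
    Injective _≡_ _≡_ v → v zero ≡ 0ᵥ →
    Generates (λ (i : Fin q) → v (suc i)) →
    HasTiling v ⇔ HasLatticeTiling v
theorem19 n q p-prime v _ v₀≡0 generates = mk⇔ to from
  where
  to : HasTiling v → HasLatticeTiling v
  to (L , tiling) = LatticeTiling.lattice-tiling p-prime v v₀≡0 generates L tiling
  from : HasLatticeTiling v → HasTiling v
  from (L , _ , tiling) = L , tiling
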